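{- Let $p$ be an odd prime, let $M$ be a finite abelian $p$-group, and let $\sigma\in\mathrm{Aut}(M)$ have order $2$. Then $\chi_M(\sigma)=(-1)^{\mathrm{ord}_p\frac{\#M}{\#M^\sigma}}$.
   Context: If $M$ has exponent $p^n$, then for $0\le i\le n-1$, $\chi_{M,i}:\mathrm{Aut}(M)\to\mathbb{F}_p^\times$ sends an automorphism to the determinant of its action on the $\mathbb{F}_p$-vector space $p^iM[p^{i+1}]$, and $\chi_M=\prod_{i=0}^{n-1}\chi_{M,i}$. $M^\sigma$ denotes the elements fixed by $\sigma$. -}

module Defs where

open import Level using (Level; _⊔_)
open import Algebra.Bundles using (AbelianGroup)
import Algebra.Definitions.RawMonoid as RawMonoidDefs
import Algebra.Morphism.Structures as MorphStr
open import Data.Nat using (ℕ; zero; suc; _^_; _<_; _≤_; _%_; _/_)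
import Data.Nat as ℕ
open import Data.Fin using (Fin; zero; suc; toℕ; punchIn)
import Data.Fin as Fin
open import Data.Integer using (ℤ; +_; -_; _-_)
import Data.Integer as ℤ
open import Data.Product using (Σ; ∃; _×_; _,_)
open import Function.Bundles using (Inverse)
open import Relation.Binary.PropositionalEquality using (_≡_)
import Relation.Binary.PropositionalEquality as ≡
open import Relation.Nullary using (¬_; Dec; yes; no; does)
open import Data.Bool using (Bool; true; false; if_then_else_)

∑ : ∀ {n} → (Fin n → ℤ) → ℤ
∑ {zero}  f = + 0
∑ {suc n} f = f zero ℤ.+ ∑ (λ i → f (suc i))

∏ : ∀ {n} → (Fin n → ℤ) → ℤ
∏ {zero}  f = + 1
∏ {suc n} f = f zero ℤ.* ∏ (λ i → f (suc i))

negOnePowℕ : ℕ → ℤ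
negOnePowℕ zero    = + 1
negOnePowℕ (suc k) = - negOnePowℕ k

-- (-1)^z for z : ℤ  (depends only on the parity of z)
negOnePow : ℤ → ℤ
negOnePow z = negOnePowℕ ℤ.∣ z ∣

-- determinant of a square integer matrix (Laplace expansion along the
-- first row; equal to the Leibniz formula)
det : ∀ {n} → (Fin n → Fin n → ℤ) → ℤ
det {zero}  A = + 1
det {suc n} A =
  ∑ (λ j → negOnePowℕ (toℕ j) ℤ.* (A zero j ℤ.* det (λ r c → A (suc r) (punchIn j c))))

-- p-adic valuation ν_p(n) of a natural number (ν_p(0) := 0; p ≤ 1 gives 0)
ν : ℕ → ℕ → ℕ
ν (suc (suc q)) n = go n n
  where
  go : ℕ → ℕ → ℕ
  go zero    m = 0
  go (suc f) zero = 0
  go (suc f) (suc m) with (suc m % suc (suc q)) ℕ.≟ 0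
  ... | yes _ = suc (go f (suc m / suc (suc q)))
  ... | no  _ = 0
ν _ n = 0

-- ord_p (a / b) = ν_p(a) - ν_p(b)  as an integer
ordp : ℕ → ℕ → ℕ → ℤ
ordp p a b = + ν p a - + ν p b

count : ∀ {n} {ℓ} {P : Fin n → Set ℓ} → ((i : Fin n) → Dec (P i)) → ℕ
count {zero}  d = 0
count {suc n} d = (if does (d zero) then 1 else 0) ℕ.+ count (λ i → d (suc i))

record FiniteAbelianGroup (c ℓ : Level) : Set (Level.suc (c ⊔ ℓ)) where
  field
    abGroup : AbelianGroup c ℓ
    card  : ℕ
    enum  : Inverse (AbelianGroup.setoid abGroup) (≡.setoid (Fin card))

  open AbelianGroup abGroup public
  open RawMonoidDefs rawMonoid public using (sum) renaming (_×_ to _·_)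
  open Inverse enum public using (to; from)

IsPGroup : ∀ {c ℓ} → ℕ → FiniteAbelianGroup c ℓ → Set
IsPGroup p M = ∃ λ k → FiniteAbelianGroup.card M ≡ p ^ k

module _ {c ℓ} (M : FiniteAbelianGroup c ℓ) where
  open FiniteAbelianGroup M
  open MorphStr.GroupMorphisms rawGroup rawGroup using (IsGroupIsomorphism)

  #_ : ℕ
  #_ = card

  IsAut : (Carrier → Carrier) → Set (c ⊔ ℓ)
  IsAut σ = IsGroupIsomorphism σ

  HasOrder2 : (Carrier → Carrier) → Set (c ⊔ ℓ)
  HasOrder2 σ = (∀ x → σ (σ x) ≈ x) × ¬ (∀ x → σ x ≈ x)

  #Fix : (Carrier → Carrier) → ℕ
  #Fix σ = count (λ i → to (σ (from i)) Fin.≟ i)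

  IsExponent : ℕ → Set (c ⊔ ℓ)
  IsExponent e = (∀ x → e · x ≈ ε)
               × (∀ m → 0 < m → (∀ x → m · x ≈ ε) → e ≤ m)

  -- membership in the F_p-space  V_i = p^i (M[p^{i+1}])
  InV : (p i : ℕ) → Carrier → Set (c ⊔ ℓ)
  InV p i x = ∃ λ y → ((p ^ suc i) · y ≈ ε) × (x ≈ (p ^ i) · y)

  lin : ∀ {p d} → (Fin d → Fin p) → (Fin d → Carrier) → Carrier
  lin coeff b = sum (λ j → toℕ (coeff j) · b j)

  record Basis (p i : ℕ) : Set (c ⊔ ℓ) where
    field
      dim   : ℕ
      vec   : Fin dim → Carrier
      inV   : ∀ j → InV p i (vec j)
      span  : ∀ x → InV p i x → ∃ λ (coeff : Fin dim → Fin p) → x ≈ lin coeff vec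
      indep : ∀ (coeff coeff′ : Fin dim → Fin p) →
              lin coeff vec ≈ lin coeff′ vec → ∀ j → coeff j ≡ coeff′ j

  -- A is the matrix (over F_p) of σ acting on V_i in the basis B:
  --   σ(b_j) = Σ_k A k j · b_k
  IsMatrixOf : ∀ {p i} (σ : Carrier → Carrier) (B : Basis p i) →
               (Fin (Basis.dim B) → Fin (Basis.dim B) → Fin p) → Set ℓ
  IsMatrixOf σ B A = ∀ j → σ (Basis.vec B j) ≈ lin (λ k → A k j) (Basis.vec B)

  -- determinant of such a matrix, as an integer representative of an
  -- element of F_p
  detℤ : ∀ {p d} → (Fin d → Fin d → Fin p) → ℤ
  detℤ A = det (λ r s → + toℕ (A r s))

-- Since p is odd, 2 is invertible modulo the exponent p^n of M, so every x splits as
-- x = π⁺ x ∙ π⁻ x with π⁺ x fixed and π⁻ x inverted by σ.  This splits M as M⁺ × M⁻ and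
-- each F_p-space V_i = p^i M[p^(i+1)] into the (±1)-eigenspaces of σ.  In an eigenbasis σ
-- acts on V_i as diag(1, …, 1, -1, …, -1), and the determinant is invariant under change
-- of basis modulo p, so χ_{M,i}(σ) ≡ (-1)^(e_i) with e_i = dim V_i⁻.  For every subgroup H,
-- x ↦ p^i x maps H[p^(i+1)] onto p^i H[p^(i+1)] with kernel H[p^i], so #H is the product of
-- the orders of its layers p^i H[p^(i+1)]; for H = M⁻ these layers are the V_i⁻, whence
-- #M⁻ = p^(Σ e_i), and ord_p(#M/#M^σ) = ord_p #M⁻ = Σ e_i.

module Submission where

open import Defs
open import Data.Nat.Base using (ℕ; suc; _^_)
import Data.Nat.Base as Nat
open import Data.Nat.Primality using (Prime)
open import Relation.Binary.PropositionalEquality using (_≢_)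

module Valuation (q : ℕ) where
  open import Data.Nat
  open import Data.Nat.Properties
  open import Data.Nat.DivMod using (m*n%n≡0; m*n/n≡m)
  open import Relation.Binary.PropositionalEquality
  open import Relation.Nullary using (yes; no; contradiction)
  open import Defs using (ν; ordp)
  open import Data.Integer.Base using (+_; _-_) renaming (_+_ to _+ℤ_)
  open import Data.Integer.Properties using (pos-+)
  open import Data.Integer.Tactic.RingSolver using (solve-∀)

  private
    p : ℕ
    p = 2 + q

  -- ν p n unfolds to a loop local to Defs that cannot be named here.  `loop` is that
  -- loop with ν's argument as an extra first parameter; it is solved by unification
  -- from `capture`, where it occurs applied to three distinct variables.
  mutual
    loop : ℕ → ℕ → ℕ → ℕ
    loop = _

    private
      capture : ∀ N → ν p (suc N) ≡ ν p (suc N)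
      capture N with suc N % p ≟ 0
      ... | no _ = refl
      ... | yes _ with suc N / p | suc N
      ... | m | n = cong suc (refl {x = loop n N m})

  loop-divisible : ∀ n f m → suc m % p ≡ 0 → loop n (suc f) (suc m) ≡ suc (loop n f (suc m / p))
  loop-divisible n f m p∣m with suc m % p ≟ 0
  ... | yes _ = refl
  ... | no p∤m = contradiction p∣m p∤m

  loop-indivisible : ∀ n f m → suc m % p ≢ 0 → loop n (suc f) (suc m) ≡ 0
  loop-indivisible n f m p∤m with suc m % p ≟ 0
  ... | yes p∣m = contradiction p∣m p∤m
  ... | no _ = refl

  loop-pow : ∀ n k f → k ≤ f → loop n f (p ^ k) ≡ k
  loop-pow n zero zero _ = refl
  loop-pow n zero (suc f) _ = loop-indivisible n f 0 (λ ())
  loop-pow n (suc k) (suc f) (s≤s k≤f) with p ^ suc k in eq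
  ... | zero = contradiction eq (≢-nonZero⁻¹ _ {{m^n≢0 p (suc k)}})
  ... | suc m = begin
    loop n (suc f) (suc m)     ≡⟨ loop-divisible n f m (subst (λ x → x % p ≡ 0) pk≡ (m*n%n≡0 (p ^ k) p)) ⟩
    suc (loop n f (suc m / p)) ≡⟨ cong (λ x → suc (loop n f x)) (subst (λ x → x / p ≡ p ^ k) pk≡ (m*n/n≡m (p ^ k) p)) ⟩
    suc (loop n f (p ^ k))     ≡⟨ cong suc (loop-pow n k f k≤f) ⟩
    suc k                      ∎
    where
    open ≡-Reasoning
    pk≡ : p ^ k * p ≡ suc m
    pk≡ = trans (*-comm (p ^ k) p) eq

  n≤p^n : ∀ n → n ≤ p ^ n
  n≤p^n zero = z≤n
  n≤p^n (suc n) = begin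
    suc n             ≤⟨ +-monoʳ-≤ 1 (n≤p^n n) ⟩
    1 + p ^ n         ≤⟨ +-monoˡ-≤ (p ^ n) (m^n>0 p n) ⟩
    p ^ n + p ^ n     ≤⟨ +-monoʳ-≤ (p ^ n) (m≤m+n (p ^ n) (q * p ^ n)) ⟩
    p ^ suc n         ∎
    where open ≤-Reasoning

  ν-pow : ∀ k → ν p (p ^ k) ≡ k
  ν-pow k = loop-pow (p ^ k) k (p ^ k) (n≤p^n k)

  ordp-pow : ∀ a b → ordp p (p ^ (a + b)) (p ^ a) ≡ + b
  ordp-pow a b = begin
    + ν p (p ^ (a + b)) - + ν p (p ^ a) ≡⟨ cong₂ (λ x y → + x - + y) (ν-pow (a + b)) (ν-pow a) ⟩
    + (a + b) - + a                     ≡⟨ cong (_- + a) (pos-+ a b) ⟩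
    (+ a +ℤ + b) - + a                  ≡⟨ cancel (+ a) (+ b) ⟩
    + b                                 ∎
    where
    open ≡-Reasoning
    cancel : ∀ x y → (x +ℤ y) - x ≡ y
    cancel = solve-∀

module Parity where
  open import Data.Nat.Base using (zero; suc; _+_; _*_; _^_; _%_; _/_; s≤s)
  open import Data.Nat.Properties using (*-comm; +-identityʳ; +-suc; +-*-semiring)
  open import Algebra.Properties.Semiring.Sum +-*-semiring using () renaming (sum to ∑ℕ)
  open import Data.Fin.Base using (Fin; zero; suc)
  import Data.Integer.Base as ℤ
  import Data.Integer.Properties as ℤₚ
  open import Data.Nat.DivMod using (m≡m%n+[m/n]*n; %-distribˡ-*; m%n<n)
  open import Data.Nat.Divisibility using (divides)
  open import Data.Nat.Primality using (Prime; prime⇒irreducible)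
  open import Data.Sum.Base using (inj₁; inj₂)
  open import Relation.Binary.PropositionalEquality
  open import Relation.Nullary using (contradiction)
  open import Function using (_∘_)

  odd-prime : ∀ {p} → Prime p → p ≢ 2 → p % 2 ≡ 1
  odd-prime {p} prime p≢2 with p % 2 | m≡m%n+[m/n]*n p 2 | m%n<n p 2
  ... | 0 | p≡[p/2]*2 | _ with prime⇒irreducible prime (divides (p / 2) p≡[p/2]*2)
  ...   | inj₁ ()
  ...   | inj₂ 2≡p = contradiction (sym 2≡p) p≢2
  odd-prime prime p≢2 | 1           | _ | _ = refl
  odd-prime prime p≢2 | suc (suc _) | _ | s≤s (s≤s ())

  odd-^ : ∀ {m} k → m % 2 ≡ 1 → m ^ k % 2 ≡ 1
  odd-^ zero    _       = refl
  odd-^ {m} (suc k) m-odd = trans (%-distribˡ-* m (m ^ k) 2) (cong₂ (λ x y → (x * y) % 2) m-odd (odd-^ k m-odd))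

  half : ∀ m → m % 2 ≡ 1 → suc (m / 2) + suc (m / 2) ≡ suc m
  half m m-odd = begin
    suc (m / 2) + suc (m / 2) ≡⟨ cong suc (+-suc (m / 2) (m / 2)) ⟩
    suc (suc (m / 2 + m / 2)) ≡⟨ cong (λ x → suc (suc x)) (trans (*-comm (m / 2) 2) (cong (m / 2 +_) (+-identityʳ (m / 2)))) ⟨
    suc (suc (m / 2 * 2))     ≡⟨ cong (λ r → suc (r + m / 2 * 2)) m-odd ⟨
    suc (m % 2 + m / 2 * 2)   ≡⟨ cong suc (m≡m%n+[m/n]*n m 2) ⟨
    suc m                     ∎
    where open ≡-Reasoning

  negOnePowℕ-+ : ∀ a b → negOnePowℕ (a + b) ≡ negOnePowℕ a ℤ.* negOnePowℕ b
  negOnePowℕ-+ zero    b = sym (ℤₚ.*-identityˡ (negOnePowℕ b))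
  negOnePowℕ-+ (suc a) b = trans (cong ℤ.-_ (negOnePowℕ-+ a b)) (ℤₚ.neg-distribˡ-* (negOnePowℕ a) (negOnePowℕ b))

  ∏-negOnePowℕ : ∀ {k} (f : Fin k → ℕ) → ∏ (negOnePowℕ ∘ f) ≡ negOnePowℕ (∑ℕ f)
  ∏-negOnePowℕ {zero}  f = refl
  ∏-negOnePowℕ {suc k} f = trans (cong (negOnePowℕ (f zero) ℤ.*_) (∏-negOnePowℕ (f ∘ suc))) (sym (negOnePowℕ-+ (f zero) (∑ℕ (f ∘ suc))))

module Congruence where
  open import Data.Nat.Base using (zero; suc; NonZero; _%_; _/_)
  open import Data.Nat.DivMod using (m≡m%n+[m/n]*n)
  import Data.Nat.Base as ℕ
  import Data.Nat.Properties as ℕ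
  open import Algebra.Properties.Semiring.Sum ℕ.+-*-semiring using () renaming (sum to ∑ℕ)
  open import Data.Fin.Base using (Fin; zero; suc)
  open import Data.Integer.Base using (ℤ; +_; _+_; _*_; _-_; -_; 0ℤ)
  open import Data.Integer.Properties using (*-zeroˡ; +-inverseʳ; pos-+; pos-*)
  open import Data.Integer.Tactic.RingSolver using (solve-∀)
  open import Data.Integer.Divisibility.Signed using (_∣_; divides; ∣m∣n⇒∣m+n; ∣m⇒∣-m; ∣m⇒∣m*n; ∣n⇒∣m*n)
  open import Algebra.Properties.Semiring.Sum Data.Integer.Properties.+-*-semiring using (sum; sum-cong-≗)
  open import Function using (_∘_)
  open import Level using (0ℓ)
  open import Relation.Binary.Bundles using (Setoid)
  open import Relation.Binary.PropositionalEquality using (_≡_; refl; sym; trans; subst; cong; cong₂)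
  import Relation.Binary.PropositionalEquality
  import Relation.Binary.Reasoning.Setoid
  open import Defs using (∏)

  infix 4 _≡_mod_
  record _≡_mod_ (a b m : ℤ) : Set where
    constructor ≡-mod
    field divides-difference : m ∣ a - b
  open _≡_mod_ public

  module _ {m : ℤ} where
    private
      via : ∀ {x y} → x ≡ y → m ∣ x → m ∣ y
      via eq = subst (m ∣_) eq

    ≡⇒≡-mod : ∀ {a b} → a ≡ b → a ≡ b mod m
    ≡⇒≡-mod {a} refl = ≡-mod (divides 0ℤ (trans (+-inverseʳ a) (sym (*-zeroˡ m))))

    ≡-mod-sym : ∀ {a b} → a ≡ b mod m → b ≡ a mod m
    ≡-mod-sym {a} {b} (≡-mod d) = ≡-mod (via (swap a b) (∣m⇒∣-m d))
      where
      swap : ∀ a b → - (a - b) ≡ b - a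
      swap = solve-∀

    ≡-mod-trans : ∀ {a b c} → a ≡ b mod m → b ≡ c mod m → a ≡ c mod m
    ≡-mod-trans {a} {b} {c} (≡-mod d) (≡-mod e) = ≡-mod (via (telescope a b c) (∣m∣n⇒∣m+n d e))
      where
      telescope : ∀ a b c → (a - b) + (b - c) ≡ a - c
      telescope = solve-∀

    +-cong-mod : ∀ {a b a′ b′} → a ≡ a′ mod m → b ≡ b′ mod m → a + b ≡ a′ + b′ mod m
    +-cong-mod {a} {b} {a′} {b′} (≡-mod d) (≡-mod e) = ≡-mod (via (regroup a b a′ b′) (∣m∣n⇒∣m+n d e))
      where
      regroup : ∀ a b a′ b′ → (a - a′) + (b - b′) ≡ (a + b) - (a′ + b′)
      regroup = solve-∀

    *-cong-mod : ∀ {a b a′ b′} → a ≡ a′ mod m → b ≡ b′ mod m → a * b ≡ a′ * b′ mod m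
    *-cong-mod {a} {b} {a′} {b′} (≡-mod d) (≡-mod e) = ≡-mod (via (regroup a b a′ b′) (∣m∣n⇒∣m+n (∣m⇒∣m*n b d) (∣n⇒∣m*n a′ e)))
      where
      regroup : ∀ a b a′ b′ → (a - a′) * b + a′ * (b - b′) ≡ a * b - a′ * b′
      regroup = solve-∀

    *-congˡ-mod : ∀ c {a b} → a ≡ b mod m → c * a ≡ c * b mod m
    *-congˡ-mod c = *-cong-mod (≡⇒≡-mod {c} refl)

    *-congʳ-mod : ∀ c {a b} → a ≡ b mod m → a * c ≡ b * c mod m
    *-congʳ-mod c a≡b = *-cong-mod a≡b (≡⇒≡-mod {c} refl)

    sum-cong-mod : ∀ {n} {f g : Fin n → ℤ} → (∀ i → f i ≡ g i mod m) → sum f ≡ sum g mod m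
    sum-cong-mod {zero}  _   = ≡⇒≡-mod refl
    sum-cong-mod {suc n} f≡g = +-cong-mod (f≡g zero) (sum-cong-mod (f≡g ∘ suc))

    ∏-cong-mod : ∀ {n} {f g : Fin n → ℤ} → (∀ i → f i ≡ g i mod m) → ∏ f ≡ ∏ g mod m
    ∏-cong-mod {zero}  _   = ≡⇒≡-mod refl
    ∏-cong-mod {suc n} f≡g = *-cong-mod (f≡g zero) (∏-cong-mod (f≡g ∘ suc))

  %-≡⇒≡-mod : ∀ p .{{_ : NonZero p}} x y → x % p ≡ y % p → + x ≡ + y mod + p
  %-≡⇒≡-mod p x y x≡y = ≡-mod (divides (+ (x / p) - + (y / p)) (begin
    + x - + y
      ≡⟨ cong₂ _-_ (expand x) (trans (expand y) (cong (λ r → + r + + (y / p) * + p) (sym x≡y))) ⟩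
    (+ (x % p) + + (x / p) * + p) - (+ (x % p) + + (y / p) * + p)
      ≡⟨ cancel (+ (x % p)) (+ (x / p)) (+ (y / p)) (+ p) ⟩
    (+ (x / p) - + (y / p)) * + p ∎))
    where
    open Relation.Binary.PropositionalEquality.≡-Reasoning
    expand : ∀ z → + z ≡ + (z % p) + + (z / p) * + p
    expand z = trans (cong +_ (m≡m%n+[m/n]*n z p)) (trans (pos-+ (z % p) _) (cong (_+_ (+ (z % p))) (pos-* (z / p) p)))
    cancel : ∀ r a b n → (r + a * n) - (r + b * n) ≡ (a - b) * n
    cancel = solve-∀

  sum-pos : ∀ {n} (f : Fin n → ℕ) → sum (λ i → + f i) ≡ + ∑ℕ f
  sum-pos {zero}  f = refl
  sum-pos {suc n} f = trans (cong (_+_ (+ f zero)) (sum-pos (f ∘ suc))) (sym (pos-+ (f zero) _))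

  sum-pos-* : ∀ {n} (f g : Fin n → ℕ) → sum (λ k → + f k * + g k) ≡ + ∑ℕ (λ k → g k ℕ.* f k)
  sum-pos-* f g = trans (sum-cong-≗ (λ k → trans (sym (pos-* (f k) (g k))) (cong +_ (ℕ.*-comm (f k) (g k)))))
                        (sum-pos (λ k → g k ℕ.* f k))

  ≡-mod-setoid : ℤ → Setoid 0ℓ 0ℓ
  ≡-mod-setoid m = record
    { Carrier = ℤ
    ; _≈_ = λ a b → a ≡ b mod m
    ; isEquivalence = record { refl = ≡⇒≡-mod refl ; sym = ≡-mod-sym ; trans = ≡-mod-trans }
    }

  module ≡-mod-Reasoning (m : ℤ) = Relation.Binary.Reasoning.Setoid (≡-mod-setoid m)

module Determinant where
  open import Data.Nat.Base as ℕ using (zero; suc)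
  import Data.Nat.Properties as ℕ
  open import Data.Fin.Base using (Fin; zero; suc; toℕ; punchIn; punchOut; inject₁; fromℕ<; splitAt)
  open import Data.Fin.Properties
    using (suc-injective; punchInᵢ≢i; punchIn-punchOut; punchOut-punchIn; punchOut-cong; toℕ-inject₁; toℕ-fromℕ<; toℕ-injective; toℕ<n)
    renaming (_≟_ to _≟ᶠ_)
  open import Data.Fin.Induction using (<-weakInduction)
  open import Data.Integer.Base using (ℤ; +0; +[1+_]; -[1+_]; -_; _+_; _*_; 0ℤ; 1ℤ; -1ℤ)
  open import Data.Integer.Properties
  open import Data.Integer.Tactic.RingSolver using (solve-∀)
  open import Data.Vec.Functional using (updateAt; _++_)
  open import Data.Sum.Base using (inj₁; inj₂)
  open import Data.Vec.Functional.Properties using (updateAt-updates; updateAt-minimal)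
  open import Algebra.Properties.Semiring.Sum +-*-semiring
    using (sum; sum-cong-≗; sum-replicate-zero; sum-remove; ∑-distrib-+; ∑-comm; *-distribˡ-sum; *-distribʳ-sum)
  open import Function using (const; _∘_)
  open import Relation.Binary.PropositionalEquality
  open import Relation.Nullary using (yes; no; contradiction)
  open import Defs using (∑; ∏; negOnePowℕ; det)
  open ≡-Reasoning

  Row : ℕ → Set
  Row n = Fin n → ℤ

  Matrix : ℕ → Set
  Matrix n = Fin n → Row n

  infix 4 _≋_
  _≋_ : ∀ {n} → Matrix n → Matrix n → Set
  A ≋ B = ∀ r → A r ≗ B r

  ∑≡sum : ∀ {n} (f : Fin n → ℤ) → ∑ f ≡ sum f
  ∑≡sum {zero} f = refl
  ∑≡sum {suc n} f = cong (f zero +_) (∑≡sum (f ∘ suc))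

  sum-zero : ∀ {n} {f : Fin n → ℤ} → f ≗ const 0ℤ → sum f ≡ 0ℤ
  sum-zero {n} f≗0 = trans (sum-cong-≗ f≗0) (sum-replicate-zero n)

  sum-neg : ∀ {n} (f : Fin n → ℤ) → sum (λ i → - f i) ≡ - sum f
  sum-neg {zero} f = refl
  sum-neg {suc n} f = trans (cong (- f zero +_) (sum-neg (f ∘ suc))) (sym (neg-distrib-+ (f zero) _))

  sum-linear : ∀ {n} a b (f g : Fin n → ℤ) → sum (λ j → a * f j + b * g j) ≡ a * sum f + b * sum g
  sum-linear a b f g = trans (∑-distrib-+ (λ j → a * f j) (λ j → b * g j)) (sym (cong₂ _+_ (*-distribˡ-sum a f) (*-distribˡ-sum b g)))

  δ : ∀ {n} → Fin n → Fin n → ℤ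
  δ zero    zero    = 1ℤ
  δ zero    (suc _) = 0ℤ
  δ (suc _) zero    = 0ℤ
  δ (suc i) (suc j) = δ i j

  I : ∀ {n} → Matrix n
  I = δ

  δ-diag : ∀ {n} (i : Fin n) → δ i i ≡ 1ℤ
  δ-diag zero = refl
  δ-diag (suc i) = δ-diag i

  δ-off : ∀ {n} {i j : Fin n} → i ≢ j → δ i j ≡ 0ℤ
  δ-off {i = zero}  {zero}  i≢j = contradiction refl i≢j
  δ-off {i = zero}  {suc j} _   = refl
  δ-off {i = suc i} {zero}  _   = refl
  δ-off {i = suc i} {suc j} i≢j = δ-off (i≢j ∘ cong suc)

  δ-sym : ∀ {n} (i j : Fin n) → δ i j ≡ δ j i
  δ-sym zero    zero    = refl
  δ-sym zero    (suc j) = refl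
  δ-sym (suc i) zero    = refl
  δ-sym (suc i) (suc j) = δ-sym i j

  δ-punchIn : ∀ {n} (j : Fin (suc n)) (r k : Fin n) → δ (punchIn j r) (punchIn j k) ≡ δ r k
  δ-punchIn zero    r       k       = refl
  δ-punchIn (suc j) zero    zero    = refl
  δ-punchIn (suc j) zero    (suc k) = refl
  δ-punchIn (suc j) (suc r) zero    = refl
  δ-punchIn (suc j) (suc r) (suc k) = δ-punchIn j r k

  sum-δˡ : ∀ {n} (j : Fin n) (f : Fin n → ℤ) → sum (λ k → δ j k * f k) ≡ f j
  sum-δˡ {suc n} zero f = begin
    1ℤ * f zero + sum (λ k → 0ℤ * f (suc k)) ≡⟨ cong₂ _+_ (*-identityˡ (f zero)) (sum-zero (*-zeroˡ ∘ f ∘ suc)) ⟩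
    f zero + 0ℤ                              ≡⟨ +-identityʳ (f zero) ⟩
    f zero                                   ∎
  sum-δˡ {suc n} (suc j) f = begin
    0ℤ * f zero + sum (λ k → δ j k * f (suc k)) ≡⟨ cong₂ _+_ (*-zeroˡ (f zero)) (sum-δˡ j (f ∘ suc)) ⟩
    0ℤ + f (suc j)                              ≡⟨ +-identityˡ (f (suc j)) ⟩
    f (suc j)                                   ∎

  sum-δʳ : ∀ {n} (j : Fin n) (f : Fin n → ℤ) → sum (λ k → f k * δ k j) ≡ f j
  sum-δʳ j f = trans (sum-cong-≗ (λ k → trans (*-comm (f k) (δ k j)) (cong (_* f k) (δ-sym k j)))) (sum-δˡ j f)

  setRow : ∀ {n} → Matrix n → Fin n → Row n → Matrix n
  setRow A r u = updateAt A r (const u)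

  setRow-at : ∀ {n} (A : Matrix n) r u → setRow A r u r ≗ u
  setRow-at A r u = cong-app (updateAt-updates r A)

  setRow-off : ∀ {n} (A : Matrix n) {r} u {i} → i ≢ r → setRow A r u i ≗ A i
  setRow-off A {r} u {i} i≢r = cong-app (updateAt-minimal i r A i≢r)

  sign : ∀ {n} → Fin n → ℤ
  sign j = negOnePowℕ (toℕ j)

  minor : ∀ {n} → Matrix (suc n) → Fin (suc n) → Matrix n
  minor A j r c = A (suc r) (punchIn j c)

  laplace : ∀ {n} → Matrix (suc n) → Fin (suc n) → ℤ
  laplace A j = sign j * (A zero j * det (minor A j))

  det-expand : ∀ {n} (A : Matrix (suc n)) → det A ≡ sum (laplace A)
  det-expand A = ∑≡sum (laplace A)

  record IsMultilinear {n} (f : Matrix n → ℤ) : Set where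
    field
      cong-≋ : ∀ {A B} → A ≋ B → f A ≡ f B
      linear : ∀ r a b {A B C : Matrix n} →
               (∀ i → i ≢ r → A i ≗ C i) → (∀ i → i ≢ r → B i ≗ C i) →
               (∀ c → C r c ≡ a * A r c + b * B r c) → f C ≡ a * f A + b * f B

  AlternatingIn : ∀ {n} → (Matrix n → ℤ) → Fin n → Fin n → Set
  AlternatingIn f r s = ∀ A → A r ≗ A s → f A ≡ 0ℤ

  IsAlternating : ∀ {n} → (Matrix n → ℤ) → Set
  IsAlternating {n} f = ∀ {r s : Fin n} → r ≢ s → AlternatingIn f r s

  module Multilinear {n} {f : Matrix n → ℤ} (ml : IsMultilinear f) where
    open IsMultilinear ml public

    additive : ∀ r {A B C : Matrix n} → (∀ i → i ≢ r → A i ≗ C i) → (∀ i → i ≢ r → B i ≗ C i) →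
               (∀ c → C r c ≡ A r c + B r c) → f C ≡ f A + f B
    additive r {A} {B} {C} A≗C B≗C Cr = begin
      f C               ≡⟨ linear r 1ℤ 1ℤ A≗C B≗C (λ c → trans (Cr c) (sym (1*x+1*y (A r c) (B r c)))) ⟩
      1ℤ * f A + 1ℤ * f B ≡⟨ 1*x+1*y (f A) (f B) ⟩
      f A + f B         ∎
      where
      1*x+1*y : ∀ x y → 1ℤ * x + 1ℤ * y ≡ x + y
      1*x+1*y x y = cong₂ _+_ (*-identityˡ x) (*-identityˡ y)

    zero-row : ∀ {A} r → A r ≗ const 0ℤ → f A ≡ 0ℤ
    zero-row {A} r Ar≗0 = begin
      f A                 ≡⟨ linear r 0ℤ 0ℤ (λ _ _ _ → refl) (λ _ _ _ → refl) (λ c → trans (Ar≗0 c) (sym (0*x+0*y (A r c) (A r c)))) ⟩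
      0ℤ * f A + 0ℤ * f A ≡⟨ 0*x+0*y (f A) (f A) ⟩
      0ℤ                  ∎
      where
      0*x+0*y : ∀ x y → 0ℤ * x + 0ℤ * y ≡ 0ℤ
      0*x+0*y x y = cong₂ _+_ (*-zeroˡ x) (*-zeroˡ y)

    linear-sum : ∀ r (A : Matrix n) {k} (a : Fin k → ℤ) (u : Fin k → Row n) {C : Matrix n} →
                 (∀ i → i ≢ r → A i ≗ C i) → (∀ c → C r c ≡ sum (λ t → a t * u t c)) →
                 f C ≡ sum (λ t → a t * f (setRow A r (u t)))
    linear-sum r A {zero} a u A≗C Cr = zero-row r Cr
    linear-sum r A {suc k} a u {C} A≗C Cr = begin
      f C                                     ≡⟨ linear r (a zero) 1ℤ (off (u zero)) (off rest) Cr′ ⟩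
      a zero * f (setRow A r (u zero)) + 1ℤ * f (setRow A r rest)
        ≡⟨ cong (a zero * f (setRow A r (u zero)) +_) (trans (*-identityˡ _) tail-sum) ⟩
      sum (λ t → a t * f (setRow A r (u t))) ∎
      where
      rest : Row n
      rest c = sum (λ t → a (suc t) * u (suc t) c)
      off : ∀ x i → i ≢ r → setRow A r x i ≗ C i
      off x i i≢r c = trans (setRow-off A x i≢r c) (A≗C i i≢r c)
      Cr′ : ∀ c → C r c ≡ a zero * setRow A r (u zero) r c + 1ℤ * setRow A r rest r c
      Cr′ c = trans (Cr c) (cong₂ _+_ (cong (a zero *_) (sym (setRow-at A r (u zero) c)))
                                      (trans (sym (*-identityˡ (rest c))) (cong (1ℤ *_) (sym (setRow-at A r rest c)))))
      tail-sum : f (setRow A r rest) ≡ sum (λ t → a (suc t) * f (setRow A r (u (suc t))))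
      tail-sum = linear-sum r A (a ∘ suc) (u ∘ suc) (λ i i≢r c → sym (setRow-off A rest i≢r c)) (setRow-at A r rest)

  module Swap {n} {f : Matrix n → ℤ} (ml : IsMultilinear f) {r s : Fin n} (r≢s : r ≢ s)
              (alt : AlternatingIn f r s) (A : Matrix n) where
    open Multilinear ml

    with₂ : Row n → Row n → Matrix n
    with₂ u v = setRow (setRow A r u) s v

    at-r : ∀ u v → with₂ u v r ≗ u
    at-r u v c = trans (setRow-off (setRow A r u) v r≢s c) (setRow-at A r u c)

    at-s : ∀ u v → with₂ u v s ≗ v
    at-s u v = setRow-at (setRow A r u) s v

    elsewhere : ∀ u v {i} → i ≢ r → i ≢ s → with₂ u v i ≗ A i
    elsewhere u v i≢r i≢s c = trans (setRow-off (setRow A r u) v i≢s c) (setRow-off A u i≢r c)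

    with₂-≋ : ∀ {u v B} → B r ≗ u → B s ≗ v → (∀ i → i ≢ r → i ≢ s → B i ≗ A i) → with₂ u v ≋ B
    with₂-≋ Br Bs Bi i c with i ≟ᶠ r | i ≟ᶠ s
    ... | yes refl | _       = trans (at-r _ _ c) (sym (Br c))
    ... | no _     | yes refl = trans (at-s _ _ c) (sym (Bs c))
    ... | no i≢r   | no i≢s  = trans (elsewhere _ _ i≢r i≢s c) (sym (Bi i i≢r i≢s c))

    g : Row n → Row n → ℤ
    g u v = f (with₂ u v)

    g-diag : ∀ u → g u u ≡ 0ℤ
    g-diag u = alt (with₂ u u) (λ c → trans (at-r u u c) (sym (at-s u u c)))

    g-addˡ : ∀ u u′ v → g (λ c → u c + u′ c) v ≡ g u v + g u′ v
    g-addˡ u u′ v = additive r off off (λ c → trans (at-r _ v c) (sym (cong₂ _+_ (at-r u v c) (at-r u′ v c))))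
      where
      off : ∀ {x} i → i ≢ r → with₂ x v i ≗ with₂ (λ c → u c + u′ c) v i
      off i i≢r c with i ≟ᶠ s
      ... | yes refl = trans (at-s _ v c) (sym (at-s _ v c))
      ... | no i≢s   = trans (elsewhere _ v i≢r i≢s c) (sym (elsewhere _ v i≢r i≢s c))

    g-addʳ : ∀ u v v′ → g u (λ c → v c + v′ c) ≡ g u v + g u v′
    g-addʳ u v v′ = additive s off off (λ c → trans (at-s u _ c) (sym (cong₂ _+_ (at-s u v c) (at-s u v′ c))))
      where
      off : ∀ {x} i → i ≢ s → with₂ u x i ≗ with₂ u (λ c → v c + v′ c) i
      off i i≢s c with i ≟ᶠ r
      ... | yes refl = trans (at-r u _ c) (sym (at-r u _ c))
      ... | no i≢r   = trans (elsewhere u _ i≢r i≢s c) (sym (elsewhere u _ i≢r i≢s c))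

    g-antisym : ∀ u v → g u v + g v u ≡ 0ℤ
    g-antisym u v = begin
      g u v + g v u                       ≡⟨ cong₂ _+_ (trans (sym (+-identityˡ (g u v))) (cong (_+ g u v) (sym (g-diag u))))
                                                       (trans (sym (+-identityʳ (g v u))) (cong (g v u +_) (sym (g-diag v)))) ⟩
      (g u u + g u v) + (g v u + g v v)   ≡⟨ cong₂ _+_ (g-addʳ u u v) (g-addʳ v u v) ⟨
      g u w + g v w                       ≡⟨ g-addˡ u v w ⟨
      g w w                               ≡⟨ g-diag w ⟩
      0ℤ                                  ∎
      where
      w : Row n
      w c = u c + v c

    swapped : Matrix n
    swapped = with₂ (A s) (A r)

    swap-rows : f swapped ≡ - f A
    swap-rows = begin
      g (A s) (A r)   ≡⟨ inverseʳ-unique (g (A r) (A s)) (g (A s) (A r)) (g-antisym (A r) (A s)) ⟩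
      - g (A r) (A s) ≡⟨ cong -_ (cong-≋ (with₂-≋ (λ _ → refl) (λ _ → refl) (λ _ _ _ _ → refl))) ⟩
      - f A           ∎
      where open import Algebra.Properties.AbelianGroup +-0-abelianGroup using (inverseʳ-unique)

  det-cong : ∀ {n} {A B : Matrix n} → A ≋ B → det A ≡ det B
  det-cong {zero} _ = refl
  det-cong {suc n} {A} {B} A≋B = begin
    det A           ≡⟨ det-expand A ⟩
    sum (laplace A) ≡⟨ sum-cong-≗ term ⟩
    sum (laplace B) ≡⟨ det-expand B ⟨
    det B           ∎
    where
    term : laplace A ≗ laplace B
    term j = cong₂ (λ x d → sign j * (x * d)) (A≋B zero j) (det-cong (λ r c → A≋B (suc r) (punchIn j c)))

  det-linear : ∀ {n} r a b {A B C : Matrix n} →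
               (∀ i → i ≢ r → A i ≗ C i) → (∀ i → i ≢ r → B i ≗ C i) →
               (∀ c → C r c ≡ a * A r c + b * B r c) → det C ≡ a * det A + b * det B
  det-linear {suc n} r a b {A} {B} {C} A≗C B≗C Cr = begin
    det C                                         ≡⟨ det-expand C ⟩
    sum (laplace C)                               ≡⟨ sum-cong-≗ (term r A≗C B≗C Cr) ⟩
    sum (λ j → a * laplace A j + b * laplace B j) ≡⟨ sum-linear a b (laplace A) (laplace B) ⟩
    a * sum (laplace A) + b * sum (laplace B)     ≡⟨ cong₂ (λ x y → a * x + b * y) (det-expand A) (det-expand B) ⟨
    a * det A + b * det B                         ∎
    where
    term : ∀ r → (∀ i → i ≢ r → A i ≗ C i) → (∀ i → i ≢ r → B i ≗ C i) →
           (∀ c → C r c ≡ a * A r c + b * B r c) → ∀ j → laplace C j ≡ a * laplace A j + b * laplace B j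
    term zero A≗C B≗C C0 j = begin
      sign j * (C zero j * det (minor C j))
        ≡⟨ cong (λ x → sign j * (x * det (minor C j))) (C0 j) ⟩
      sign j * ((a * A zero j + b * B zero j) * det (minor C j))
        ≡⟨ distribute a b (sign j) (A zero j) (B zero j) (det (minor C j)) ⟩
      a * (sign j * (A zero j * det (minor C j))) + b * (sign j * (B zero j * det (minor C j)))
        ≡⟨ cong₂ (λ x y → a * (sign j * (A zero j * x)) + b * (sign j * (B zero j * y)))
                 (det-cong (λ r c → sym (A≗C (suc r) (λ ()) (punchIn j c))))
                 (det-cong (λ r c → sym (B≗C (suc r) (λ ()) (punchIn j c)))) ⟩
      a * laplace A j + b * laplace B j ∎
      where
      distribute : ∀ a b s x y d → s * ((a * x + b * y) * d) ≡ a * (s * (x * d)) + b * (s * (y * d))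
      distribute = solve-∀
    term (suc r) A≗C B≗C Cr j = begin
      sign j * (C zero j * det (minor C j))
        ≡⟨ cong (λ d → sign j * (C zero j * d)) minor-linear ⟩
      sign j * (C zero j * (a * det (minor A j) + b * det (minor B j)))
        ≡⟨ distribute a b (sign j) (C zero j) (det (minor A j)) (det (minor B j)) ⟩
      a * (sign j * (C zero j * det (minor A j))) + b * (sign j * (C zero j * det (minor B j)))
        ≡⟨ cong₂ (λ x y → a * (sign j * (x * det (minor A j))) + b * (sign j * (y * det (minor B j))))
                 (sym (A≗C zero (λ ()) j)) (sym (B≗C zero (λ ()) j)) ⟩
      a * laplace A j + b * laplace B j ∎
      where
      distribute : ∀ a b s x dA dB → s * (x * (a * dA + b * dB)) ≡ a * (s * (x * dA)) + b * (s * (x * dB))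
      distribute = solve-∀
      minor-linear : det (minor C j) ≡ a * det (minor A j) + b * det (minor B j)
      minor-linear = det-linear r a b (λ i i≢r c → A≗C (suc i) (i≢r ∘ suc-injective) (punchIn j c))
                                      (λ i i≢r c → B≗C (suc i) (i≢r ∘ suc-injective) (punchIn j c))
                                      (Cr ∘ punchIn j)

  det-multilinear : ∀ {n} → IsMultilinear (det {n})
  det-multilinear = record { cong-≋ = det-cong ; linear = det-linear }

  sign-punchOut : ∀ {m} {j x : Fin (suc (suc m))} (j≢x : j ≢ x) (x≢j : x ≢ j) →
                  sign x * sign (punchOut x≢j) ≡ - (sign j * sign (punchOut j≢x))
  sign-punchOut {j = zero} {zero} j≢x _ = contradiction refl j≢x
  sign-punchOut {j = zero} {suc x} _ _ = trans (*-identityʳ (- sign x)) (cong -_ (sym (*-identityˡ (sign x))))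
  sign-punchOut {j = suc j} {zero} _ _ = trans (*-identityˡ (sign j)) (sym (trans (cong -_ (*-identityʳ (- sign j))) (neg-involutive (sign j))))
  sign-punchOut {zero} {j = suc zero} {suc zero} j≢x _ = contradiction refl j≢x
  sign-punchOut {suc m} {j = suc j} {suc x} j≢x x≢j = begin
    - sign x * - sign po      ≡⟨ neg*neg (sign x) (sign po) ⟩
    sign x * sign po          ≡⟨ sign-punchOut (j≢x ∘ cong suc) (x≢j ∘ cong suc) ⟩
    - (sign j * sign po′)     ≡⟨ cong -_ (neg*neg (sign j) (sign po′)) ⟨
    - (- sign j * - sign po′) ∎
    where
    po = punchOut (x≢j ∘ cong suc)
    po′ = punchOut (j≢x ∘ cong suc)
    neg*neg : ∀ a b → - a * - b ≡ a * b
    neg*neg = solve-∀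

  punchIn-punchOut-comm : ∀ {m} {j x : Fin (suc (suc m))} (j≢x : j ≢ x) (x≢j : x ≢ j) (c : Fin m) →
                          punchIn j (punchIn (punchOut j≢x) c) ≡ punchIn x (punchIn (punchOut x≢j) c)
  punchIn-punchOut-comm {j = zero} {zero} j≢x _ _ = contradiction refl j≢x
  punchIn-punchOut-comm {j = zero} {suc x} _ _ _ = refl
  punchIn-punchOut-comm {j = suc j} {zero} _ _ _ = refl
  punchIn-punchOut-comm {zero} {j = suc zero} {suc zero} j≢x _ _ = contradiction refl j≢x
  punchIn-punchOut-comm {suc m} {j = suc j} {suc x} _ _ zero = refl
  punchIn-punchOut-comm {suc m} {j = suc j} {suc x} j≢x x≢j (suc c) =
    cong suc (punchIn-punchOut-comm (j≢x ∘ cong suc) (x≢j ∘ cong suc) c)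

  private
    module FirstTwoRowsEqual {m} (A : Matrix (suc (suc m))) (A0≗A1 : A zero ≗ A (suc zero)) where
      v : Row (suc (suc m))
      v = A zero

      rest : ∀ {j x} → j ≢ x → ℤ
      rest {j} j≢x = det (λ r c → A (suc (suc r)) (punchIn j (punchIn (punchOut j≢x) c)))

      -- term (j, x) of the Laplace expansion along rows 0 and 1
      S : Fin (suc (suc m)) → Fin (suc (suc m)) → ℤ
      S j x with j ≟ᶠ x
      ... | yes _   = 0ℤ
      ... | no j≢x = sign j * sign (punchOut j≢x) * (v j * v x * rest j≢x)

      S-diag : ∀ j → S j j ≡ 0ℤ
      S-diag j with j ≟ᶠ j
      ... | yes _  = refl
      ... | no j≢j = contradiction refl j≢j

      S-punchIn : ∀ j k → S j (punchIn j k) ≡ laplace (minor A j) k * (sign j * v j)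
      S-punchIn j k with j ≟ᶠ punchIn j k
      ... | yes j≡ = contradiction (sym j≡) (punchInᵢ≢i j k)
      ... | no j≢ = begin
        sign j * sign (punchOut j≢) * (v j * v (punchIn j k) * rest j≢)
          ≡⟨ cong (λ k′ → sign j * sign k′ * (v j * v (punchIn j k) * det (λ r c → A (suc (suc r)) (punchIn j (punchIn k′ c)))))
                  (trans (punchOut-cong j refl) (punchOut-punchIn j)) ⟩
        sign j * sign k * (v j * v (punchIn j k) * det (minor (minor A j) k))
          ≡⟨ rearrange (sign j) (sign k) (v j) (v (punchIn j k)) (det (minor (minor A j) k)) ⟩
        sign k * (v (punchIn j k) * det (minor (minor A j) k)) * (sign j * v j)
          ≡⟨ cong (λ y → sign k * (y * det (minor (minor A j) k)) * (sign j * v j)) (A0≗A1 (punchIn j k)) ⟩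
        laplace (minor A j) k * (sign j * v j) ∎
        where
        rearrange : ∀ sj sk vj vx d → sj * sk * (vj * vx * d) ≡ sk * (vx * d) * (sj * vj)
        rearrange = solve-∀

      S-antisym : ∀ j x → S x j ≡ - S j x
      S-antisym j x with x ≟ᶠ j | j ≟ᶠ x
      ... | yes _   | yes _   = refl
      ... | yes x≡j | no j≢x = contradiction (sym x≡j) j≢x
      ... | no x≢j | yes j≡x = contradiction (sym j≡x) x≢j
      ... | no x≢j | no j≢x = begin
        sign x * sign (punchOut x≢j) * (v x * v j * rest x≢j)
          ≡⟨ cong₂ (λ s d → s * (v x * v j * d)) (sign-punchOut j≢x x≢j)
                   (det-cong (λ r c → cong (A (suc (suc r))) (sym (punchIn-punchOut-comm j≢x x≢j c)))) ⟩
        - (sign j * sign (punchOut j≢x)) * (v x * v j * rest j≢x)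
          ≡⟨ rearrange (sign j * sign (punchOut j≢x)) (v x) (v j) (rest j≢x) ⟩
        - (sign j * sign (punchOut j≢x) * (v j * v x * rest j≢x)) ∎
        where
        rearrange : ∀ s a b d → - s * (a * b * d) ≡ - (s * (b * a * d))
        rearrange = solve-∀

      expand-twice : det A ≡ sum (λ j → sum (S j))
      expand-twice = trans (det-expand A) (sum-cong-≗ λ j → begin
        sign j * (v j * det (minor A j))                        ≡⟨ cong (λ d → sign j * (v j * d)) (det-expand (minor A j)) ⟩
        sign j * (v j * sum (laplace (minor A j)))              ≡⟨ rearrange (sign j) (v j) _ ⟩
        sum (laplace (minor A j)) * (sign j * v j)              ≡⟨ *-distribʳ-sum (sign j * v j) (laplace (minor A j)) ⟩
        sum (λ k → laplace (minor A j) k * (sign j * v j))      ≡⟨ sum-cong-≗ (λ k → sym (S-punchIn j k)) ⟩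
        sum (λ k → S j (punchIn j k))                           ≡⟨ trans (cong (_+ sum (λ k → S j (punchIn j k))) (S-diag j)) (+-identityˡ _) ⟨
        S j j + sum (λ k → S j (punchIn j k))                   ≡⟨ sum-remove (S j) ⟨
        sum (S j)                                               ∎)
        where
        rearrange : ∀ s a d → s * (a * d) ≡ d * (s * a)
        rearrange = solve-∀

      double-sum-antisym : sum (λ j → sum (S j)) ≡ - sum (λ j → sum (S j))
      double-sum-antisym = begin
        sum (λ j → sum (λ x → S j x))   ≡⟨ ∑-comm S ⟩
        sum (λ x → sum (λ j → S j x))   ≡⟨ sum-cong-≗ (λ x → sum-cong-≗ (S-antisym x)) ⟩
        sum (λ x → sum (λ j → - S x j)) ≡⟨ sum-cong-≗ (λ x → sum-neg (S x)) ⟩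
        sum (λ x → - sum (S x))         ≡⟨ sum-neg (λ x → sum (S x)) ⟩
        - sum (λ j → sum (S j))         ∎

      det≡0 : det A ≡ 0ℤ
      det≡0 = trans expand-twice (x≡-x⇒x≡0 _ double-sum-antisym)
        where
        x≡-x⇒x≡0 : ∀ x → x ≡ - x → x ≡ 0ℤ
        x≡-x⇒x≡0 +0 _ = refl
        x≡-x⇒x≡0 +[1+ _ ] ()
        x≡-x⇒x≡0 -[1+ _ ] ()

  private
    module AlternatingStep {n} (ih : IsAlternating (det {n})) where
      lower : ∀ {r s : Fin n} → r ≢ s → AlternatingIn (det {suc n}) (suc r) (suc s)
      lower r≢s A Ar≗As = trans (det-expand A) (sum-zero λ j → begin
        sign j * (A zero j * det (minor A j)) ≡⟨ cong (λ d → sign j * (A zero j * d)) (ih r≢s (minor A j) (Ar≗As ∘ punchIn j)) ⟩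
        sign j * (A zero j * 0ℤ)              ≡⟨ cong (sign j *_) (*-zeroʳ (A zero j)) ⟩
        sign j * 0ℤ                           ≡⟨ *-zeroʳ (sign j) ⟩
        0ℤ                                    ∎)

      -- rows 0 and 2 + s are handled by swapping rows 1 and 2 + s, which lower covers
      first : ∀ s → AlternatingIn (det {suc n}) zero (suc s)
      first zero A A0≗A1 = FirstTwoRowsEqual.det≡0 A A0≗A1
      first (suc s) A A0≗A2+s = neg-injective (trans (sym swap-rows) (first zero swapped swapped-01))
        where
        open Swap det-multilinear {suc zero} {suc (suc s)} (λ ()) (lower {zero} {suc s} (λ ())) A
        swapped-01 : swapped zero ≗ swapped (suc zero)
        swapped-01 c = trans (elsewhere (A (suc (suc s))) (A (suc zero)) (λ ()) (λ ()) c)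
                             (trans (A0≗A2+s c) (sym (at-r (A (suc (suc s))) (A (suc zero)) c)))

      alternating : IsAlternating (det {suc n})
      alternating {zero}  {zero}  0≢0 = contradiction refl 0≢0
      alternating {zero}  {suc s} _   = first s
      alternating {suc r} {zero}  _   = λ A Ar≗A0 → first r A (sym ∘ Ar≗A0)
      alternating {suc r} {suc s} r≢s = lower (r≢s ∘ cong suc)

  det-alternating : ∀ {n} → IsAlternating (det {n})
  det-alternating {zero} {()}
  det-alternating {suc n} = AlternatingStep.alternating det-alternating

  punchIn-suc-self : ∀ {m} (j : Fin m) → punchIn (suc j) j ≡ inject₁ j
  punchIn-suc-self zero    = refl
  punchIn-suc-self (suc j) = cong suc (punchIn-suc-self j)

  punchIn-inject₁-self : ∀ {m} (j : Fin m) → punchIn (inject₁ j) j ≡ suc j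
  punchIn-inject₁-self zero    = refl
  punchIn-inject₁-self (suc j) = cong suc (punchIn-inject₁-self j)

  punchIn-suc≡punchIn-inject₁ : ∀ {m} {j r : Fin m} → r ≢ j → punchIn (suc j) r ≡ punchIn (inject₁ j) r
  punchIn-suc≡punchIn-inject₁ {j = zero}  {zero}  r≢j = contradiction refl r≢j
  punchIn-suc≡punchIn-inject₁ {j = zero}  {suc r} _   = refl
  punchIn-suc≡punchIn-inject₁ {j = suc j} {zero}  _   = refl
  punchIn-suc≡punchIn-inject₁ {j = suc j} {suc r} r≢j = cong suc (punchIn-suc≡punchIn-inject₁ (r≢j ∘ cong suc))

  embedRow : ∀ {m} → Fin (suc m) → Row m → Row (suc m)
  embedRow j x c with j ≟ᶠ c
  ... | yes _  = 0ℤ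
  ... | no j≢c = x (punchOut j≢c)

  -- e_j on top of X, with a zero column inserted at position j
  embed : ∀ {m} → Fin (suc m) → Matrix m → Matrix (suc m)
  embed j X zero    = δ j
  embed j X (suc r) = embedRow j (X r)

  embedRow-cong : ∀ {m} (j : Fin (suc m)) {x y : Row m} → x ≗ y → embedRow j x ≗ embedRow j y
  embedRow-cong j x≗y c with j ≟ᶠ c
  ... | yes _  = refl
  ... | no j≢c = x≗y (punchOut j≢c)

  embedRow-linear : ∀ {m} (j : Fin (suc m)) a b (x y : Row m) →
                    embedRow j (λ c → a * x c + b * y c) ≗ (λ c → a * embedRow j x c + b * embedRow j y c)
  embedRow-linear j a b x y c with j ≟ᶠ c
  ... | yes _ = sym (cong₂ _+_ (*-zeroʳ a) (*-zeroʳ b))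
  ... | no _  = refl

  embedRow-δ : ∀ {m} (j : Fin (suc m)) (r : Fin m) → embedRow j (δ r) ≗ δ (punchIn j r)
  embedRow-δ j r c with j ≟ᶠ c
  ... | yes refl = sym (δ-off (punchInᵢ≢i j r))
  ... | no j≢c   = trans (sym (δ-punchIn j r (punchOut j≢c))) (cong (δ (punchIn j r)) (punchIn-punchOut j≢c))

  embedRow-split : ∀ {m} (j : Fin (suc m)) (x : Row (suc m)) c → x c ≡ embedRow j (x ∘ punchIn j) c + x j * δ j c
  embedRow-split j x c with j ≟ᶠ c
  ... | yes refl = sym (trans (+-identityˡ _) (trans (cong (x j *_) (δ-diag j)) (*-identityʳ (x j))))
  ... | no j≢c   = sym (trans (cong₂ _+_ (cong x (punchIn-punchOut j≢c)) (trans (cong (x j *_) (δ-off j≢c)) (*-zeroʳ (x j))))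
                               (+-identityʳ (x c)))

  -- the identity matrix with its row j moved to the top, past j other rows
  raise : ∀ {m} → Fin (suc m) → Matrix (suc m)
  raise j zero    = δ j
  raise j (suc r) = δ (punchIn j r)

  embed-I : ∀ {m} (j : Fin (suc m)) → embed j I ≋ raise j
  embed-I j zero    = λ _ → refl
  embed-I j (suc r) = embedRow-δ j r

  module _ {m} {f : Matrix (suc m) → ℤ} (ml : IsMultilinear f) (alt : IsAlternating f) where
    open Multilinear ml

    f-raise : ∀ j → f (raise j) ≡ sign j * f I
    f-raise = <-weakInduction (λ j → f (raise j) ≡ sign j * f I) base step
      where
      base : f (raise zero) ≡ 1ℤ * f I
      base = trans (cong-≋ (λ { zero _ → refl ; (suc r) _ → refl })) (sym (*-identityˡ (f I)))
      step : ∀ j → f (raise (inject₁ j)) ≡ sign (inject₁ j) * f I → f (raise (suc j)) ≡ sign (suc j) * f I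
      step j ih = begin
        f (raise (suc j))             ≡⟨ cong-≋ raise-swapped ⟨
        f swapped                     ≡⟨ swap-rows ⟩
        - f (raise (inject₁ j))       ≡⟨ cong -_ ih ⟩
        - (sign (inject₁ j) * f I)    ≡⟨ neg-distribˡ-* (sign (inject₁ j)) (f I) ⟩
        - sign (inject₁ j) * f I      ≡⟨ cong (λ k → - negOnePowℕ k * f I) (toℕ-inject₁ j) ⟩
        sign (suc j) * f I            ∎
        where
        open Swap ml {zero} {suc j} (λ ()) (alt (λ ())) (raise (inject₁ j))
        raise-swapped : swapped ≋ raise (suc j)
        raise-swapped = with₂-≋ (λ c → cong (λ k → δ k c) (sym (punchIn-inject₁-self j)))
                                (λ c → cong (λ k → δ k c) (punchIn-suc-self j))
                                other
          where
          other : ∀ i → i ≢ zero → i ≢ suc j → raise (suc j) i ≗ raise (inject₁ j) i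
          other zero    0≢0 _     = contradiction refl 0≢0
          other (suc r) _   r≢j c = cong (λ k → δ k c) (punchIn-suc≡punchIn-inject₁ (r≢j ∘ cong suc))

    add-multiple-of-first-row : ∀ r κ {X Y : Matrix (suc m)} → (∀ i → i ≢ suc r → Y i ≗ X i) →
                                (∀ c → X (suc r) c ≡ Y (suc r) c + κ * Y zero c) → f X ≡ f Y
    add-multiple-of-first-row r κ {X} {Y} Y≗X Xr = begin
      f X                  ≡⟨ linear (suc r) 1ℤ κ Y≗X B≗X (λ c → trans (Xr c) (cong₂ _+_ (sym (*-identityˡ (Y (suc r) c))) (cong (κ *_) (sym (setRow-at Y (suc r) (Y zero) c))))) ⟩
      1ℤ * f Y + κ * f B   ≡⟨ cong₂ _+_ (*-identityˡ (f Y)) (trans (cong (κ *_) fB≡0) (*-zeroʳ κ)) ⟩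
      f Y + 0ℤ             ≡⟨ +-identityʳ (f Y) ⟩
      f Y                  ∎
      where
      B : Matrix (suc m)
      B = setRow Y (suc r) (Y zero)
      B≗X : ∀ i → i ≢ suc r → B i ≗ X i
      B≗X i i≢r c = trans (setRow-off Y (Y zero) i≢r c) (Y≗X i i≢r c)
      fB≡0 : f B ≡ 0ℤ
      fB≡0 = alt {zero} {suc r} (λ ()) B (λ c → trans (setRow-off Y {suc r} (Y zero) (λ ()) c) (sym (setRow-at Y (suc r) (Y zero) c)))

    private
      module Clearing {X Y : Matrix (suc m)} (X0≗Y0 : X zero ≗ Y zero) (κ : Fin m → ℤ)
                      (Xr : ∀ r c → X (suc r) c ≡ Y (suc r) c + κ r * Y zero c) where
        mix : ℕ → Matrix (suc m)
        mix t zero = Y zero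
        mix t (suc r) with toℕ r ℕ.<? t
        ... | yes _ = Y (suc r)
        ... | no _  = X (suc r)

        X≋mix0 : X ≋ mix 0
        X≋mix0 zero    = X0≗Y0
        X≋mix0 (suc r) _ = refl

        mixm≋Y : mix m ≋ Y
        mixm≋Y zero    _ = refl
        mixm≋Y (suc r) _ with toℕ r ℕ.<? m
        ... | yes _ = refl
        ... | no r≮m = contradiction (toℕ<n r) r≮m

        mix-off : ∀ t r → toℕ r ≢ t → mix (suc t) (suc r) ≗ mix t (suc r)
        mix-off t r r≢t _ with toℕ r ℕ.<? suc t | toℕ r ℕ.<? t
        ... | yes _     | yes _  = refl
        ... | no _      | no _   = refl
        ... | no r≮1+t  | yes r<t = contradiction (ℕ.m<n⇒m<1+n r<t) r≮1+t
        ... | yes r<1+t | no r≮t = contradiction (ℕ.≤-antisym (ℕ.s≤s⁻¹ r<1+t) (ℕ.≮⇒≥ r≮t)) r≢t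

        mix-at : ∀ t r → toℕ r ≡ t → ∀ c → mix t (suc r) c ≡ mix (suc t) (suc r) c + κ r * Y zero c
        mix-at t r refl c with toℕ r ℕ.<? suc t | toℕ r ℕ.<? t
        ... | yes _    | no _    = Xr r c
        ... | _        | yes r<r = contradiction r<r (ℕ.<-irrefl refl)
        ... | no r≮1+r | _       = contradiction (ℕ.n<1+n (toℕ r)) r≮1+r

        step : ∀ t → f (mix t) ≡ f (mix (suc t))
        step t with t ℕ.<? m
        ... | yes t<m = add-multiple-of-first-row r₀ (κ r₀) off (mix-at t r₀ (toℕ-fromℕ< t<m))
          where
          r₀ = fromℕ< t<m
          off : ∀ i → i ≢ suc r₀ → mix (suc t) i ≗ mix t i
          off zero    _     _ = refl
          off (suc r) r≢r₀ = mix-off t r (λ r≡t → r≢r₀ (cong suc (toℕ-injective (trans r≡t (sym (toℕ-fromℕ< t<m))))))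
        ... | no t≮m = cong-≋ λ { zero _ → refl ; (suc r) → λ c → sym (mix-off t r (λ r≡t → t≮m (subst (ℕ._< m) r≡t (toℕ<n r))) c) }

        steps : ∀ t → f (mix 0) ≡ f (mix t)
        steps zero    = refl
        steps (suc t) = trans (steps t) (step t)

    clear-first-row-multiples : ∀ {X Y : Matrix (suc m)} → X zero ≗ Y zero → (κ : Fin m → ℤ) →
                                (∀ r c → X (suc r) c ≡ Y (suc r) c + κ r * Y zero c) → f X ≡ f Y
    clear-first-row-multiples {X} {Y} X0≗Y0 κ Xr = begin
      f X       ≡⟨ cong-≋ X≋mix0 ⟩
      f (mix 0) ≡⟨ steps m ⟩
      f (mix m) ≡⟨ cong-≋ mixm≋Y ⟩
      f Y       ∎
      where open Clearing {X} {Y} X0≗Y0 κ Xr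

    restrict : Fin (suc m) → Matrix m → ℤ
    restrict j X = f (embed j X)

    restrict-multilinear : ∀ j → IsMultilinear (restrict j)
    restrict-multilinear j = record
      { cong-≋ = λ X≋Y → cong-≋ λ { zero _ → refl ; (suc r) → embedRow-cong j (X≋Y r) }
      ; linear = λ r a b {X} {Y} {Z} X≗Z Y≗Z Zr →
          linear (suc r) a b (lift X≗Z) (lift Y≗Z) (λ c → trans (embedRow-cong j Zr c) (embedRow-linear j a b (X r) (Y r) c))
      }
      where
      lift : ∀ {r} {X Z : Matrix m} → (∀ i → i ≢ r → X i ≗ Z i) → ∀ i → i ≢ suc r → embed j X i ≗ embed j Z i
      lift X≗Z zero    _     _ = refl
      lift X≗Z (suc i) i≢r = embedRow-cong j (X≗Z i (i≢r ∘ cong suc))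

    restrict-alternating : ∀ j → IsAlternating (restrict j)
    restrict-alternating j r≢s X Xr≗Xs = alt (r≢s ∘ suc-injective) (embed j X) (embedRow-cong j Xr≗Xs)

  det-unique : ∀ {n} {f : Matrix n → ℤ} → IsMultilinear f → IsAlternating f → ∀ A → f A ≡ det A * f I
  det-unique {zero} {f} ml alt A = trans (IsMultilinear.cong-≋ ml (λ ())) (sym (*-identityˡ (f I)))
  det-unique {suc m} {f} ml alt A = begin
    f A                                                  ≡⟨ linear-sum zero A (A zero) δ (λ _ _ _ → refl) (λ c → sym (sum-δʳ c (A zero))) ⟩
    sum (λ j → A zero j * f (setRow A zero (δ j)))       ≡⟨ sum-cong-≗ (λ j → cong (A zero j *_) (unit-first-row j)) ⟩
    sum (λ j → A zero j * (det (minor A j) * (sign j * f I))) ≡⟨ sum-cong-≗ (λ j → rearrange (A zero j) (det (minor A j)) (sign j) (f I)) ⟩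
    sum (λ j → laplace A j * f I)                        ≡⟨ *-distribʳ-sum (f I) (laplace A) ⟨
    sum (laplace A) * f I                                ≡⟨ cong (_* f I) (det-expand A) ⟨
    det A * f I                                          ∎
    where
    open Multilinear ml
    rearrange : ∀ a d s x → a * (d * (s * x)) ≡ s * (a * d) * x
    rearrange = solve-∀
    unit-first-row : ∀ j → f (setRow A zero (δ j)) ≡ det (minor A j) * (sign j * f I)
    unit-first-row j = begin
      f (setRow A zero (δ j))         ≡⟨ clear-first-row-multiples ml alt (setRow-at A zero (δ j)) (λ r → A (suc r) j)
                                           (λ r c → embedRow-split j (A (suc r)) c) ⟩
      restrict ml alt j (minor A j)   ≡⟨ det-unique (restrict-multilinear ml alt j) (restrict-alternating ml alt j) (minor A j) ⟩
      det (minor A j) * f (embed j I) ≡⟨ cong (λ x → det (minor A j) * x) (trans (cong-≋ (embed-I j)) (f-raise ml alt j)) ⟩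
      det (minor A j) * (sign j * f I) ∎

  infixl 7 _⊗_
  _⊗_ : ∀ {n} → Matrix n → Matrix n → Matrix n
  (A ⊗ B) r c = sum (λ k → A r k * B k c)

  det-⊗ : ∀ {n} (A B : Matrix n) → det (A ⊗ B) ≡ det A * det B
  det-⊗ {n} A B = begin
    det (A ⊗ B)         ≡⟨ det-unique ml alt A ⟩
    det A * det (I ⊗ B) ≡⟨ cong (det A *_) (det-cong (λ r c → sum-δˡ r (λ k → B k c))) ⟩
    det A * det B       ∎
    where
    ⊗B-rows : ∀ {r} {X Y : Matrix n} → (∀ i → i ≢ r → X i ≗ Y i) → ∀ i → i ≢ r → (X ⊗ B) i ≗ (Y ⊗ B) i
    ⊗B-rows X≗Y i i≢r c = sum-cong-≗ (λ k → cong (_* B k c) (X≗Y i i≢r k))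
    distribute : ∀ a x b y z → (a * x + b * y) * z ≡ a * (x * z) + b * (y * z)
    distribute = solve-∀
    ml : IsMultilinear (λ X → det (X ⊗ B))
    ml = record
      { cong-≋ = λ X≋Y → det-cong (λ r c → sum-cong-≗ (λ k → cong (_* B k c) (X≋Y r k)))
      ; linear = λ r a b {X} {Y} {Z} X≗Z Y≗Z Zr → det-linear r a b (⊗B-rows X≗Z) (⊗B-rows Y≗Z) λ c →
          trans (sum-cong-≗ (λ k → trans (cong (_* B k c) (Zr k)) (distribute a (X r k) b (Y r k) (B k c))))
                (sum-linear a b (λ k → X r k * B k c) (λ k → Y r k * B k c))
      }
    alt : IsAlternating (λ X → det (X ⊗ B))
    alt r≢s X Xr≗Xs = det-alternating r≢s (X ⊗ B) (λ c → sum-cong-≗ (λ k → cong (_* B k c) (Xr≗Xs k)))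

  diagonal : ∀ {n} → (Fin n → ℤ) → Matrix n
  diagonal s r c = δ r c * s r

  ⊗-diagonal : ∀ {n} (A : Matrix n) (s : Fin n → ℤ) r c → (A ⊗ diagonal s) r c ≡ A r c * s c
  ⊗-diagonal A s r c = trans (sum-cong-≗ (λ k → rearrange (A r k) (δ k c) (s k))) (sum-δʳ c (λ k → A r k * s k))
    where
    rearrange : ∀ a d x → a * (d * x) ≡ a * x * d
    rearrange = solve-∀

  det-diagonal : ∀ {n} (s : Fin n → ℤ) → det (diagonal s) ≡ ∏ s
  det-diagonal {zero}  s = refl
  det-diagonal {suc n} s = begin
    det (diagonal s)                                              ≡⟨ det-expand (diagonal s) ⟩
    1ℤ * (1ℤ * s zero * det (minor (diagonal s) zero)) + sum (laplace (diagonal s) ∘ suc)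
      ≡⟨ cong₂ _+_ (trans (*-identityˡ _) (cong (_* det (diagonal (s ∘ suc))) (*-identityˡ (s zero)))) (sum-zero off-diagonal) ⟩
    s zero * det (diagonal (s ∘ suc)) + 0ℤ                       ≡⟨ +-identityʳ _ ⟩
    s zero * det (diagonal (s ∘ suc))                            ≡⟨ cong (s zero *_) (det-diagonal (s ∘ suc)) ⟩
    s zero * ∏ (s ∘ suc)                                         ∎
    where
    off-diagonal : ∀ j → laplace (diagonal s) (suc j) ≡ 0ℤ
    off-diagonal j = begin
      sign (suc j) * (0ℤ * s zero * det (minor (diagonal s) (suc j))) ≡⟨ cong (λ x → sign (suc j) * (x * det (minor (diagonal s) (suc j)))) (*-zeroˡ (s zero)) ⟩
      sign (suc j) * (0ℤ * det (minor (diagonal s) (suc j)))         ≡⟨ cong (sign (suc j) *_) (*-zeroˡ (det (minor (diagonal s) (suc j)))) ⟩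
      sign (suc j) * 0ℤ                                             ≡⟨ *-zeroʳ (sign (suc j)) ⟩
      0ℤ                                                            ∎

  det-I : ∀ {n} → det (I {n}) ≡ 1ℤ
  det-I {n} = trans (det-cong {n} {I} {diagonal (const 1ℤ)} (λ r c → sym (*-identityʳ (δ r c)))) (trans (det-diagonal {n} (const 1ℤ)) (∏-ones n))
    where
    ∏-ones : ∀ n → ∏ {n} (const 1ℤ) ≡ 1ℤ
    ∏-ones zero    = refl
    ∏-ones (suc n) = trans (*-identityˡ (∏ {n} (const 1ℤ))) (∏-ones n)

  signs : ∀ a e → Fin (a ℕ.+ e) → ℤ
  signs a e = _++_ {m = a} (const 1ℤ) (const -1ℤ)

  ∏-signs : ∀ a e → ∏ (signs a e) ≡ negOnePowℕ e
  ∏-signs zero    zero    = refl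
  ∏-signs zero    (suc e) = trans (-1*i≡-i (∏ (signs zero e))) (cong -_ (∏-signs zero e))
  ∏-signs (suc a) e       = trans (*-identityˡ (∏ (signs (suc a) e ∘ suc))) (trans (∏-cong tail-signs) (∏-signs a e))
    where
    ∏-cong : ∀ {n} {f g : Fin n → ℤ} → f ≗ g → ∏ f ≡ ∏ g
    ∏-cong {zero}  _   = refl
    ∏-cong {suc n} f≗g = cong₂ _*_ (f≗g zero) (∏-cong (f≗g ∘ suc))
    tail-signs : signs (suc a) e ∘ suc ≗ signs a e
    tail-signs i with splitAt a i
    ... | inj₁ _ = refl
    ... | inj₂ _ = refl

module DeterminantModulo where
  open import Data.Nat.Base using (zero; suc)
  open import Data.Fin.Base using (zero; suc; punchIn)
  open import Data.Integer.Base using (_*_; 1ℤ)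
  open import Data.Integer.Properties using (*-identityʳ; *-assoc)
  open import Data.Integer.Tactic.RingSolver using (solve-∀)
  open import Algebra.Properties.Semiring.Sum Data.Integer.Properties.+-*-semiring using (sum)
  open import Relation.Binary.PropositionalEquality using (_≡_; refl; sym; cong)
  open import Defs using (det)
  open Determinant
  open Congruence

  det-cong-mod : ∀ {n m} {A B : Matrix n} → (∀ r c → A r c ≡ B r c mod m) → det A ≡ det B mod m
  det-cong-mod {zero}  _   = ≡⇒≡-mod refl
  det-cong-mod {suc n} {m} {A} {B} A≡B = begin
    det A           ≡⟨ det-expand A ⟩
    sum (laplace A) ≈⟨ sum-cong-mod (λ j → *-congˡ-mod (sign j) (*-cong-mod (A≡B zero j) (det-cong-mod (λ r c → A≡B (suc r) (punchIn j c))))) ⟩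
    sum (laplace B) ≡⟨ det-expand B ⟨
    det B           ∎
    where open ≡-mod-Reasoning m

  det-conjugate-mod : ∀ {n m} {A D P Q : Matrix n} →
                      (∀ r c → (A ⊗ P) r c ≡ (P ⊗ D) r c mod m) → (∀ r c → (P ⊗ Q) r c ≡ I r c mod m) →
                      det A ≡ det D mod m
  det-conjugate-mod {n} {m} {A} {D} {P} {Q} AP≡PD PQ≡I = begin
    det A                         ≡⟨ *-identityʳ (det A) ⟨
    det A * 1ℤ                    ≈⟨ *-congˡ-mod (det A) (≡-mod-sym det-PQ) ⟩
    det A * (det P * det Q)       ≡⟨ *-assoc (det A) (det P) (det Q) ⟨
    det A * det P * det Q         ≡⟨ cong (_* det Q) (det-⊗ A P) ⟨
    det (A ⊗ P) * det Q           ≈⟨ *-congʳ-mod (det Q) (det-cong-mod AP≡PD) ⟩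
    det (P ⊗ D) * det Q           ≡⟨ cong (_* det Q) (det-⊗ P D) ⟩
    det P * det D * det Q         ≡⟨ swap-middle (det P) (det D) (det Q) ⟩
    det D * (det P * det Q)       ≈⟨ *-congˡ-mod (det D) det-PQ ⟩
    det D * 1ℤ                    ≡⟨ *-identityʳ (det D) ⟩
    det D                         ∎
    where
    open ≡-mod-Reasoning m
    swap-middle : ∀ p d q → p * d * q ≡ d * (p * q)
    swap-middle = solve-∀
    det-PQ : det P * det Q ≡ 1ℤ mod m
    det-PQ = ≡-mod-trans (≡⇒≡-mod (sym (det-⊗ P Q))) (≡-mod-trans (det-cong-mod PQ≡I) (≡⇒≡-mod (det-I {n})))

module Counting where
  open import Data.Nat.Base using (zero; suc; _+_; _*_)
  open import Data.Nat.Properties using (+-*-semiring; +-identityʳ; *-comm)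
  open import Algebra.Properties.Semiring.Sum +-*-semiring using (sum; sum-cong-≗; ∑-comm; *-distribʳ-sum)
  open import Data.Fin.Base using (Fin; zero; suc; funToFin; combine)
  open import Data.Fin.Properties using (suc-injective) renaming (_≟_ to _≟ᶠ_)
  open import Data.Product using (_,_; proj₁; proj₂)
  open import Data.Bool.Base using (if_then_else_)
  open import Function using (_∘_)
  open import Level using (Level)
  open import Relation.Binary.PropositionalEquality
  open import Relation.Nullary using (¬_; Dec; yes; no; does; _×-dec_; contradiction)
  open import Defs using (count)
  open ≡-Reasoning

  private
    variable
      a b : Level
      N K : ℕ

  indicator : {A : Set a} → Dec A → ℕ
  indicator d = if does d then 1 else 0

  count≡sum : ∀ {P : Fin N → Set a} (P? : ∀ i → Dec (P i)) → count P? ≡ sum (indicator ∘ P?)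
  count≡sum {N = zero}  P? = refl
  count≡sum {N = suc N} P? = cong (indicator (P? zero) +_) (count≡sum (P? ∘ suc))

  count-cong : ∀ {P : Fin N → Set a} {Q : Fin N → Set b} (P? : ∀ i → Dec (P i)) (Q? : ∀ i → Dec (Q i)) →
               (∀ i → P i → Q i) → (∀ i → Q i → P i) → count P? ≡ count Q?
  count-cong {N = zero}  P? Q? P⇒Q Q⇒P = refl
  count-cong {N = suc N} P? Q? P⇒Q Q⇒P = cong₂ _+_ head (count-cong (P? ∘ suc) (Q? ∘ suc) (P⇒Q ∘ suc) (Q⇒P ∘ suc))
    where
    head : indicator (P? zero) ≡ indicator (Q? zero)
    head with P? zero | Q? zero
    ... | yes _  | yes _  = refl
    ... | no _   | no _   = refl
    ... | yes p  | no ¬q = contradiction (P⇒Q zero p) ¬q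
    ... | no ¬p | yes q  = contradiction (Q⇒P zero q) ¬p

  count-none : ∀ {P : Fin N → Set a} (P? : ∀ i → Dec (P i)) → (∀ i → ¬ P i) → count P? ≡ 0
  count-none {N = zero}  P? ¬P = refl
  count-none {N = suc N} P? ¬P with P? zero
  ... | yes p = contradiction p (¬P zero)
  ... | no _  = count-none (P? ∘ suc) (¬P ∘ suc)

  count-all : ∀ {P : Fin N → Set a} (P? : ∀ i → Dec (P i)) → (∀ i → P i) → count P? ≡ N
  count-all {N = zero}  P? P = refl
  count-all {N = suc N} P? P with P? zero
  ... | yes _  = cong suc (count-all (P? ∘ suc) (P ∘ suc))
  ... | no ¬p = contradiction (P zero) ¬p

  count-unique : ∀ {P : Fin N → Set a} (P? : ∀ i → Dec (P i)) i₀ → P i₀ → (∀ i → P i → i ≡ i₀) → count P? ≡ 1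
  count-unique {N = suc N} P? zero Pi₀ unique with P? zero
  ... | yes _  = cong suc (count-none (P? ∘ suc) (λ i Pi → 0≢1+ (sym (unique (suc i) Pi))))
    where
    0≢1+ : ∀ {i : Fin N} → zero ≢ suc i
    0≢1+ ()
  ... | no ¬p = contradiction Pi₀ ¬p
  count-unique {N = suc N} P? (suc i₀) Pi₀ unique with P? zero
  ... | yes p = contradiction (unique zero p) (λ ())
  ... | no _  = count-unique (P? ∘ suc) i₀ Pi₀ (λ i Pi → suc-injective (unique (suc i) Pi))

  count-fibres : ∀ {P : Fin N → Set a} {R : Fin K → Set b} (P? : ∀ i → Dec (P i)) (R? : ∀ j → Dec (R j))
                 (f : Fin N → Fin K) c → (∀ i → P i → R (f i)) →
                 (∀ j → R j → count (λ i → P? i ×-dec (f i ≟ᶠ j)) ≡ c) → count P? ≡ c * count R?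
  count-fibres {P = P} {R} P? R? f c P⇒R fibre = begin
    count P?                                               ≡⟨ count≡sum P? ⟩
    sum (indicator ∘ P?)                                   ≡⟨ sum-cong-≗ split ⟩
    sum (λ i → sum (λ j → indicator (P? i ×-dec (f i ≟ᶠ j)))) ≡⟨ ∑-comm (λ i j → indicator (P? i ×-dec (f i ≟ᶠ j))) ⟩
    sum (λ j → sum (λ i → indicator (P? i ×-dec (f i ≟ᶠ j)))) ≡⟨ sum-cong-≗ fibre-size ⟩
    sum (λ j → indicator (R? j) * c)                       ≡⟨ *-distribʳ-sum c (indicator ∘ R?) ⟨
    sum (indicator ∘ R?) * c                               ≡⟨ cong (_* c) (count≡sum R?) ⟨
    count R? * c                                           ≡⟨ *-comm (count R?) c ⟩
    c * count R?                                           ∎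
    where
    split : ∀ i → indicator (P? i) ≡ sum (λ j → indicator (P? i ×-dec (f i ≟ᶠ j)))
    split i with P? i
    ... | yes p  = sym (trans (sym (count≡sum (λ j → yes p ×-dec (f i ≟ᶠ j))))
                              (count-unique (λ j → yes p ×-dec (f i ≟ᶠ j)) (f i) (p , refl) (λ j → sym ∘ proj₂)))
    ... | no ¬p = sym (trans (sym (count≡sum (λ j → no ¬p ×-dec (f i ≟ᶠ j))))
                             (count-none (λ j → no ¬p ×-dec (f i ≟ᶠ j)) (λ j → ¬p ∘ proj₁)))
    fibre-size : ∀ j → sum (λ i → indicator (P? i ×-dec (f i ≟ᶠ j))) ≡ indicator (R? j) * c
    fibre-size j with R? j
    ... | yes r  = trans (sym (count≡sum (λ i → P? i ×-dec (f i ≟ᶠ j)))) (trans (fibre j r) (sym (+-identityʳ c)))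
    ... | no ¬r = trans (sym (count≡sum (λ i → P? i ×-dec (f i ≟ᶠ j))))
                        (count-none (λ i → P? i ×-dec (f i ≟ᶠ j)) (λ { i (Pi , refl) → ¬r (P⇒R i Pi) }))

  count-bijection : ∀ {P : Fin N → Set a} {Q : Fin K → Set b} (P? : ∀ i → Dec (P i)) (Q? : ∀ j → Dec (Q j))
                    (f : Fin N → Fin K) (g : Fin K → Fin N) → (∀ i → P i → Q (f i)) → (∀ j → Q j → P (g j)) →
                    (∀ i → P i → g (f i) ≡ i) → (∀ j → Q j → f (g j) ≡ j) → count P? ≡ count Q?
  count-bijection {Q = Q} P? Q? f g P⇒Q Q⇒P gf fg =
    trans (count-fibres P? Q? f 1 P⇒Q fibre) (+-identityʳ (count Q?))
    where
    fibre : ∀ j → Q j → count (λ i → P? i ×-dec (f i ≟ᶠ j)) ≡ 1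
    fibre j q = count-unique (λ i → P? i ×-dec (f i ≟ᶠ j)) (g j) (Q⇒P j q , fg j q)
                             (λ { i (Pi , refl) → sym (gf i Pi) })

  funToFin-cong : ∀ {d p} {f g : Fin d → Fin p} → f ≗ g → funToFin f ≡ funToFin g
  funToFin-cong {zero}  _   = refl
  funToFin-cong {suc d} f≗g = cong₂ combine (f≗g zero) (funToFin-cong (f≗g ∘ suc))

module FiniteGroup {c ℓ} (M : FiniteAbelianGroup c ℓ) where
  open import Data.Nat.Base using (zero; suc; _+_; _*_)
  open import Data.Fin.Base using (Fin; zero; suc; _↑ˡ_; _↑ʳ_)
  open import Data.Fin.Properties using (any?) renaming (_≟_ to _≟ᶠ_)
  open import Data.Product using (∃; _×_; _,_; proj₁; proj₂; map₂)
  open import Data.Unit.Base using (tt)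
  open import Function using (_∘_)
  open import Function.Bundles using (Inverse)
  open import Level using (Level; _⊔_)
  import Relation.Binary.PropositionalEquality as ≡
  open import Relation.Binary.Definitions using (_Respects_)
  open import Relation.Nullary using (Dec; yes; map′; _×-dec_)
  open import Relation.Unary using (Pred; Decidable; U; _∩_)
  open import Defs using (count)
  open Counting
  open FiniteAbelianGroup M public
  open import Algebra.Properties.AbelianGroup abGroup public
    using (∙-cancelˡ; ∙-cancelʳ; //-rightDividesˡ; //-rightDividesʳ; ⁻¹-∙-comm; ⁻¹-involutive; ε⁻¹≈ε; inverseˡ-unique; inverseʳ-unique)
  open import Algebra.Properties.Monoid.Mult monoid public using (×-congʳ; ×-homo-+; ×-assocˡ; ×-homo-1)
  open import Algebra.Properties.CommutativeMonoid.Mult commutativeMonoid public using (×-distrib-+)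
  open import Algebra.Properties.CommutativeMonoid.Sum commutativeMonoid public using (∑-comm; ∑-distrib-+; sum-cong-≋)
  open import Relation.Binary.Reasoning.Setoid setoid

  private
    variable
      a b h k r : Level

  to-from : ∀ i → to (from i) ≡.≡ i
  to-from i = Inverse.inverseˡ enum refl

  from-to : ∀ x → from (to x) ≈ x
  from-to x = Inverse.inverseʳ enum ≡.refl

  to-cong : ∀ {x y} → x ≈ y → to x ≡.≡ to y
  to-cong = Inverse.to-cong enum

  to-injective : ∀ {x y} → to x ≡.≡ to y → x ≈ y
  to-injective {x} {y} eq = trans (sym (from-to x)) (trans (reflexive (≡.cong from eq)) (from-to y))

  infix 4 _≈?_
  _≈?_ : ∀ x y → Dec (x ≈ y)
  x ≈? y = map′ to-injective to-cong (to x ≟ᶠ to y)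

  ∃? : {P : Pred Carrier a} → P Respects _≈_ → Decidable P → Dec (∃ P)
  ∃? P-resp P? = map′ (λ (i , Pi) → from i , Pi) (λ (x , Px) → to x , P-resp (sym (from-to x)) Px) (any? (P? ∘ from))

  sum-ε : ∀ {k} (f : Fin k → Carrier) → (∀ i → f i ≈ ε) → sum f ≈ ε
  sum-ε {zero}  f f≈ε = refl
  sum-ε {suc k} f f≈ε = trans (∙-cong (f≈ε zero) (sum-ε (f ∘ suc) (f≈ε ∘ suc))) (identityˡ ε)

  sum-↑ : ∀ m {n} (f : Fin (m + n) → Carrier) → sum f ≈ sum (λ i → f (i ↑ˡ n)) ∙ sum (λ i → f (m ↑ʳ i))
  sum-↑ zero    f = sym (identityˡ (sum f))
  sum-↑ (suc m) f = trans (∙-congˡ (sum-↑ m (f ∘ suc))) (sym (assoc (f zero) _ _))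

  size : {P : Pred Carrier a} → Decidable P → ℕ
  size P? = count (P? ∘ from)

  size-cong : ∀ {P : Pred Carrier a} {Q : Pred Carrier b} (P? : Decidable P) (Q? : Decidable Q) →
              (∀ {x} → P x → Q x) → (∀ {x} → Q x → P x) → size P? ≡.≡ size Q?
  size-cong P? Q? P⇒Q Q⇒P = count-cong (P? ∘ from) (Q? ∘ from) (λ _ → P⇒Q) (λ _ → Q⇒P)

  size-bijection : ∀ {P : Pred Carrier a} {Q : Pred Carrier b} (P? : Decidable P) (Q? : Decidable Q) →
                   P Respects _≈_ → Q Respects _≈_ →
                   (φ ψ : Carrier → Carrier) → (∀ {x y} → x ≈ y → φ x ≈ φ y) → (∀ {x y} → x ≈ y → ψ x ≈ ψ y) →
                   (∀ {x} → P x → Q (φ x)) → (∀ {y} → Q y → P (ψ y)) →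
                   (∀ {x} → P x → ψ (φ x) ≈ x) → (∀ {y} → Q y → φ (ψ y) ≈ y) → size P? ≡.≡ size Q?
  size-bijection P? Q? P-resp Q-resp φ ψ φ-cong ψ-cong P⇒Q Q⇒P ψφ φψ =
    count-bijection (P? ∘ from) (Q? ∘ from) (λ i → to (φ (from i))) (λ j → to (ψ (from j)))
      (λ i Pi → Q-resp (sym (from-to _)) (P⇒Q Pi)) (λ j Qj → P-resp (sym (from-to _)) (Q⇒P Qj))
      (λ i Pi → ≡.trans (to-cong (trans (ψ-cong (from-to _)) (ψφ Pi))) (to-from i))
      (λ j Qj → ≡.trans (to-cong (trans (φ-cong (from-to _)) (φψ Qj))) (to-from j))

  size-fibres : ∀ {P : Pred Carrier a} {R : Pred Carrier b} (P? : Decidable P) (R? : Decidable R) → R Respects _≈_ →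
                (φ : Carrier → Carrier) → ∀ c → (∀ {x} → P x → R (φ x)) →
                (∀ {y} → R y → size (λ x → P? x ×-dec (φ x ≈? y)) ≡.≡ c) → size P? ≡.≡ c * size R?
  size-fibres P? R? R-resp φ c P⇒R fibre =
    count-fibres (P? ∘ from) (R? ∘ from) (λ i → to (φ (from i))) c (λ i Pi → R-resp (sym (from-to _)) (P⇒R Pi))
      (λ j Rj → ≡.trans (count-cong _ (λ i → P? (from i) ×-dec (φ (from i) ≈? from j))
                                      (λ i → map₂ (λ eq → to-injective (≡.trans eq (≡.sym (to-from j)))))
                                      (λ i → map₂ (λ eq → ≡.trans (to-cong eq) (to-from j))))
                        (fibre Rj))

  record IsEndomorphism (φ : Carrier → Carrier) : Set (c ⊔ ℓ) where
    field
      cong   : ∀ {x y} → x ≈ y → φ x ≈ φ y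
      ∙-homo : ∀ x y → φ (x ∙ y) ≈ φ x ∙ φ y

    ε-homo : φ ε ≈ ε
    ε-homo = ∙-cancelʳ (φ ε) (φ ε) ε (begin
      φ ε ∙ φ ε ≈⟨ ∙-homo ε ε ⟨
      φ (ε ∙ ε) ≈⟨ cong (identityˡ ε) ⟩
      φ ε       ≈⟨ identityˡ (φ ε) ⟨
      ε ∙ φ ε   ∎)

    ⁻¹-homo : ∀ x → φ (x ⁻¹) ≈ φ x ⁻¹
    ⁻¹-homo x = inverseʳ-unique (φ x) (φ (x ⁻¹)) (begin
      φ x ∙ φ (x ⁻¹) ≈⟨ ∙-homo x (x ⁻¹) ⟨
      φ (x ∙ x ⁻¹)   ≈⟨ cong (inverseʳ x) ⟩
      φ ε            ≈⟨ ε-homo ⟩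
      ε              ∎)

    ×-homo : ∀ n x → φ (n · x) ≈ n · φ x
    ×-homo zero    x = ε-homo
    ×-homo (suc n) x = trans (∙-homo x (n · x)) (∙-congˡ (×-homo n x))

    sum-homo : ∀ {k} (f : Fin k → Carrier) → φ (sum f) ≈ sum (φ ∘ f)
    sum-homo {zero}  f = ε-homo
    sum-homo {suc k} f = trans (∙-homo (f zero) (sum (f ∘ suc))) (∙-congˡ (sum-homo (f ∘ suc)))

  ×-endomorphism : ∀ m → IsEndomorphism (m ·_)
  ×-endomorphism m = record { cong = ×-congʳ m ; ∙-homo = λ x y → ×-distrib-+ x y m }

  record Subgroup (H : Pred Carrier h) : Set (c ⊔ ℓ ⊔ h) where
    field
      dec       : Decidable H
      resp      : H Respects _≈_
      ε-closed  : H ε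
      ∙-closed  : ∀ {x y} → H x → H y → H (x ∙ y)
      ⁻¹-closed : ∀ {x} → H x → H (x ⁻¹)

    ×-closed : ∀ n {x} → H x → H (n · x)
    ×-closed zero    _  = ε-closed
    ×-closed (suc n) Hx = ∙-closed Hx (×-closed n Hx)

    sum-closed : ∀ {k} (f : Fin k → Carrier) → (∀ i → H (f i)) → H (sum f)
    sum-closed {zero}  f Hf = ε-closed
    sum-closed {suc k} f Hf = ∙-closed (Hf zero) (sum-closed (f ∘ suc) (Hf ∘ suc))

    order : ℕ
    order = size dec

  open Subgroup using (order)

  whole : Subgroup U
  whole = record { dec = λ _ → yes tt ; resp = λ _ _ → tt ; ε-closed = tt ; ∙-closed = λ _ _ → tt ; ⁻¹-closed = λ _ → tt }

  infixr 6 _∩ˢ_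
  _∩ˢ_ : {H : Pred Carrier h} {K : Pred Carrier k} → Subgroup H → Subgroup K → Subgroup (H ∩ K)
  S ∩ˢ T = record
    { dec       = λ x → S.dec x ×-dec T.dec x
    ; resp      = λ x≈y (Hx , Kx) → S.resp x≈y Hx , T.resp x≈y Kx
    ; ε-closed  = S.ε-closed , T.ε-closed
    ; ∙-closed  = λ (Hx , Kx) (Hy , Ky) → S.∙-closed Hx Hy , T.∙-closed Kx Ky
    ; ⁻¹-closed = λ (Hx , Kx) → S.⁻¹-closed Hx , T.⁻¹-closed Kx
    }
    where
    module S = Subgroup S
    module T = Subgroup T

  subgroup-⇔ : {H : Pred Carrier h} {K : Pred Carrier k} → (∀ {x} → H x → K x) → (∀ {x} → K x → H x) →
               Subgroup H → Subgroup K
  subgroup-⇔ H⇒K K⇒H S = record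
    { dec       = λ x → map′ H⇒K K⇒H (dec x)
    ; resp      = λ x≈y → H⇒K ∘ resp x≈y ∘ K⇒H
    ; ε-closed  = H⇒K ε-closed
    ; ∙-closed  = λ Kx Ky → H⇒K (∙-closed (K⇒H Kx) (K⇒H Ky))
    ; ⁻¹-closed = H⇒K ∘ ⁻¹-closed ∘ K⇒H
    }
    where open Subgroup S

  Kernel : (Carrier → Carrier) → Pred Carrier ℓ
  Kernel φ x = φ x ≈ ε

  kernel : ∀ {φ} → IsEndomorphism φ → Subgroup (Kernel φ)
  kernel {φ} endo = record
    { dec       = λ x → φ x ≈? ε
    ; resp      = λ x≈y φx≈ε → trans (E.cong (sym x≈y)) φx≈ε
    ; ε-closed  = E.ε-homo
    ; ∙-closed  = λ {x} {y} φx≈ε φy≈ε → trans (E.∙-homo x y) (trans (∙-cong φx≈ε φy≈ε) (identityˡ ε))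
    ; ⁻¹-closed = λ {x} φx≈ε → trans (E.⁻¹-homo x) (trans (⁻¹-cong φx≈ε) ε⁻¹≈ε)
    }
    where module E = IsEndomorphism endo

  Torsion : ℕ → Pred Carrier ℓ
  Torsion m = Kernel (m ·_)

  torsion : ∀ m → Subgroup (Torsion m)
  torsion m = kernel (×-endomorphism m)

  Image : (Carrier → Carrier) → Pred Carrier h → Pred Carrier (c ⊔ ℓ ⊔ h)
  Image φ H x = ∃ λ y → H y × x ≈ φ y

  image : ∀ {φ} {H : Pred Carrier h} → IsEndomorphism φ → Subgroup H → Subgroup (Image φ H)
  image {φ = φ} {H} endo S = record
    { dec       = λ x → ∃? (λ y≈y′ (Hy , x≈φy) → resp y≈y′ Hy , trans x≈φy (E.cong y≈y′)) (λ y → dec y ×-dec (x ≈? φ y))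
    ; resp      = λ x≈x′ (y , Hy , x≈φy) → y , Hy , trans (sym x≈x′) x≈φy
    ; ε-closed  = ε , ε-closed , sym E.ε-homo
    ; ∙-closed  = λ (y , Hy , x≈φy) (y′ , Hy′ , x′≈φy′) →
                    y ∙ y′ , ∙-closed Hy Hy′ , trans (∙-cong x≈φy x′≈φy′) (sym (E.∙-homo y y′))
    ; ⁻¹-closed = λ (y , Hy , x≈φy) → y ⁻¹ , ⁻¹-closed Hy , trans (⁻¹-cong x≈φy) (sym (E.⁻¹-homo y))
    }
    where
    open Subgroup S
    module E = IsEndomorphism endo

  -- the first isomorphism theorem, counted: φ maps H onto R with kernel K
  order-by-kernel : ∀ {φ} {H : Pred Carrier h} {K : Pred Carrier k} {R : Pred Carrier r} →
                    IsEndomorphism φ → (SH : Subgroup H) (K? : Decidable K) (R? : Decidable R) → R Respects _≈_ →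
                    (∀ {x} → H x → R (φ x)) → (∀ {y} → R y → ∃ λ x → H x × φ x ≈ y) →
                    (∀ {x} → K x → H x × φ x ≈ ε) → (∀ {x} → H x → φ x ≈ ε → K x) →
                    order SH ≡.≡ size K? * size R?
  order-by-kernel {φ = φ} {H} {K} {R} endo SH K? R? R-resp image preimage kernel⇒ ⇒kernel =
    size-fibres dec R? R-resp φ (size K?) image fibre
    where
    open Subgroup SH
    open IsEndomorphism endo renaming (cong to φ-cong; ∙-homo to φ-∙)
    K-resp : K Respects _≈_
    K-resp x≈y Kx = ⇒kernel (resp x≈y (proj₁ (kernel⇒ Kx))) (trans (φ-cong (sym x≈y)) (proj₂ (kernel⇒ Kx)))
    fibre : ∀ {y} → R y → size (λ x → dec x ×-dec (φ x ≈? y)) ≡.≡ size K?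
    fibre {y} Ry = size-bijection (λ x → dec x ×-dec (φ x ≈? y)) K? Fibre-resp K-resp (_∙ x₀ ⁻¹) (_∙ x₀)
                     (λ e → ∙-congʳ e) (λ e → ∙-congʳ e) shift unshift
                     (λ _ → //-rightDividesˡ x₀ _) (λ _ → //-rightDividesʳ x₀ _)
      where
      x₀ = proj₁ (preimage Ry)
      Hx₀ = proj₁ (proj₂ (preimage Ry))
      φx₀≈y = proj₂ (proj₂ (preimage Ry))
      Fibre-resp : (λ x → H x × φ x ≈ y) Respects _≈_
      Fibre-resp x≈x′ (Hx , φx≈y) = resp x≈x′ Hx , trans (φ-cong (sym x≈x′)) φx≈y
      shift : ∀ {x} → H x × φ x ≈ y → K (x ∙ x₀ ⁻¹)
      shift {x} (Hx , φx≈y) = ⇒kernel (∙-closed Hx (⁻¹-closed Hx₀)) (∙-cancelʳ (φ x₀) _ _ (begin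
        φ (x ∙ x₀ ⁻¹) ∙ φ x₀ ≈⟨ φ-∙ (x ∙ x₀ ⁻¹) x₀ ⟨
        φ (x ∙ x₀ ⁻¹ ∙ x₀)   ≈⟨ φ-cong (//-rightDividesˡ x₀ x) ⟩
        φ x                  ≈⟨ trans φx≈y (sym φx₀≈y) ⟩
        φ x₀                 ≈⟨ identityˡ (φ x₀) ⟨
        ε ∙ φ x₀             ∎))
      unshift : ∀ {k} → K k → H (k ∙ x₀) × φ (k ∙ x₀) ≈ y
      unshift {k} Kk = ∙-closed (proj₁ (kernel⇒ Kk)) Hx₀ , (begin
        φ (k ∙ x₀)   ≈⟨ φ-∙ k x₀ ⟩
        φ k ∙ φ x₀   ≈⟨ ∙-congʳ (proj₂ (kernel⇒ Kk)) ⟩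
        ε ∙ φ x₀     ≈⟨ identityˡ (φ x₀) ⟩
        φ x₀         ≈⟨ φx₀≈y ⟩
        y            ∎)

module Layers {c ℓ} (M : FiniteAbelianGroup c ℓ) (p : ℕ) where
  open import Data.Nat.Base using (zero; suc; _+_; _*_; _^_)
  open import Data.Nat.Properties using (+-*-semiring; ^-distribˡ-+-*)
  open import Algebra.Properties.Semiring.Sum +-*-semiring using (sum-syntax; sum-init-last; sum-cong-≗)
  open import Data.Fin.Base using (toℕ)
  open import Data.Fin.Properties using (toℕ-inject₁; toℕ-fromℕ)
  open import Data.Product using (_,_)
  open import Level using (_⊔_)
  open import Relation.Unary using (Pred; _∩_)
  import Relation.Binary.PropositionalEquality as ≡
  open FiniteGroup M
  open Subgroup using (order; dec; resp)
  open Counting using (count-unique)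

  module _ {h} {H : Pred Carrier h} (S : Subgroup H) where
    -- p^k (H ∩ M[p^(k+1)]); for H = M this is the F_p-space V_k of the statement
    Layer : ℕ → Pred Carrier (c ⊔ ℓ ⊔ h)
    Layer k = Image ((p ^ k) ·_) (H ∩ Torsion (p ^ suc k))

    layer : ∀ k → Subgroup (Layer k)
    layer k = image (×-endomorphism (p ^ k)) (S ∩ˢ torsion (p ^ suc k))

    layer-killed : ∀ {k x} → Layer k x → Torsion p x
    layer-killed {k} {x} (y , (_ , p^[1+k]y≈ε) , x≈p^ky) = begin
      p · x           ≈⟨ ×-congʳ p x≈p^ky ⟩
      p · (p ^ k) · y ≈⟨ ×-assocˡ y p (p ^ k) ⟩
      (p ^ suc k) · y ≈⟨ p^[1+k]y≈ε ⟩
      ε               ∎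
      where open import Relation.Binary.Reasoning.Setoid setoid

    order-torsion-zero : order (S ∩ˢ torsion 1) ≡.≡ 1
    order-torsion-zero =
      count-unique (dec (S ∩ˢ torsion 1) ∘ from) (to ε) (resp (S ∩ˢ torsion 1) (sym (from-to ε)) (Subgroup.ε-closed (S ∩ˢ torsion 1)))
        (λ i (_ , 1x≈ε) → ≡.trans (≡.sym (to-from i)) (to-cong (trans (sym (×-homo-1 (from i))) 1x≈ε)))
      where open import Function using (_∘_)

    order-torsion-suc : ∀ k → order (S ∩ˢ torsion (p ^ suc k)) ≡.≡ order (S ∩ˢ torsion (p ^ k)) * order (layer k)
    order-torsion-suc k =
      order-by-kernel (×-endomorphism (p ^ k)) (S ∩ˢ torsion (p ^ suc k)) (dec (S ∩ˢ torsion (p ^ k))) (dec (layer k)) (resp (layer k))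
        (λ {y} Hy → y , Hy , refl)
        (λ (y , Hy , x≈p^ky) → y , Hy , sym x≈p^ky)
        (λ {x} (Hx , p^kx≈ε) → (Hx , trans (sym (×-assocˡ x p (p ^ k))) (trans (×-congʳ p p^kx≈ε) (IsEndomorphism.ε-homo (×-endomorphism p)))) , p^kx≈ε)
        (λ (Hx , _) p^kx≈ε → Hx , p^kx≈ε)

    order-torsion : (d : ℕ → ℕ) → (∀ k → order (layer k) ≡.≡ p ^ d k) →
                    ∀ n → order (S ∩ˢ torsion (p ^ n)) ≡.≡ p ^ (∑[ i < n ] d (toℕ i))
    order-torsion d layer≡ zero    = order-torsion-zero
    order-torsion d layer≡ (suc n) = begin
      order (S ∩ˢ torsion (p ^ suc n))                   ≡⟨ order-torsion-suc n ⟩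
      order (S ∩ˢ torsion (p ^ n)) * order (layer n)     ≡⟨ ≡.cong₂ _*_ (order-torsion d layer≡ n) (layer≡ n) ⟩
      p ^ (∑[ i < n ] d (toℕ i)) * p ^ d n      ≡⟨ ^-distribˡ-+-* p (∑[ i < n ] d (toℕ i)) (d n) ⟨
      p ^ ((∑[ i < n ] d (toℕ i)) + d n)        ≡⟨ ≡.cong (p ^_) (≡.sym sum-last) ⟩
      p ^ (∑[ i < suc n ] d (toℕ i))          ∎
      where
      open ≡.≡-Reasoning
      sum-last : (∑[ i < suc n ] d (toℕ i)) ≡.≡ (∑[ i < n ] d (toℕ i)) + d n
      sum-last = ≡.trans (sum-init-last {n} (λ i → d (toℕ i)))
                         (≡.cong₂ _+_ (sum-cong-≗ {n} (λ i → ≡.cong d (toℕ-inject₁ i))) (≡.cong d (toℕ-fromℕ n)))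

module ElementaryAbelian {c ℓ} (M : FiniteAbelianGroup c ℓ) (q : ℕ) where
  open import Data.Nat.Base using (zero; suc; _+_; _*_; _∸_; _^_; _%_; _/_; _<_)
  import Data.Nat.Properties as ℕ
  open import Data.Nat.DivMod using (m≡m%n+[m/n]*n; m%n<n)
  open import Data.Nat.Primality using (Prime)
  open import Data.Nat.Coprimality using (coprime-Bézout; prime⇒coprime)
  open import Data.Nat.GCD using (module Bézout)
  open import Algebra.Properties.Semiring.Sum ℕ.+-*-semiring using () renaming (sum to ∑ℕ)
  open import Data.Fin.Base using (Fin; zero; suc; toℕ; fromℕ<; funToFin; finToFun)
  open import Data.Fin.Properties using (toℕ-fromℕ<; toℕ-injective; toℕ<n; any?; finToFun-funToFin; funToFin-finToFin)
  open import Data.Vec.Functional using (_∷_)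
  open import Data.Product using (Σ; ∃; _,_; proj₁; proj₂)
  open import Data.Unit.Base using (⊤; tt)
  open import Function using (_∘_)
  open import Level using (_⊔_)
  open import Relation.Binary.Definitions using (tri<; tri≈; tri>)
  import Relation.Binary.PropositionalEquality as ≡
  open import Relation.Nullary using (¬_; Dec; yes; no; map′; contradiction)
  open import Data.Empty using (⊥; ⊥-elim)
  open import Relation.Unary using (Pred)
  open import Defs using (lin)
  open FiniteGroup M
  open Counting
  open import Data.Fin.Properties using () renaming (_≟_ to _≟ᶠ_)
  open import Relation.Binary.Reasoning.Setoid setoid

  p : ℕ
  p = 2 + q

  linℕ : ∀ {k} → (Fin k → ℕ) → (Fin k → Carrier) → Carrier
  linℕ a v = sum (λ j → a j · v j)

  linℕ-cong : ∀ {k} {a a′ : Fin k → ℕ} {v v′ : Fin k → Carrier} → (∀ j → a j ≡.≡ a′ j) → (∀ j → v j ≈ v′ j) →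
              linℕ a v ≈ linℕ a′ v′
  linℕ-cong {a′ = a′} a≡a′ v≈v′ = sum-cong-≋ (λ j → trans (reflexive (≡.cong (_· _) (a≡a′ j))) (×-congʳ (a′ j) (v≈v′ j)))

  linℕ-congʳ : ∀ {k} (a : Fin k → ℕ) {v v′ : Fin k → Carrier} → (∀ j → v j ≈ v′ j) → linℕ a v ≈ linℕ a v′
  linℕ-congʳ a = linℕ-cong {a = a} (λ _ → ≡.refl)

  linℕ-+ : ∀ {k} (a a′ : Fin k → ℕ) v → linℕ (λ j → a j + a′ j) v ≈ linℕ a v ∙ linℕ a′ v
  linℕ-+ a a′ v = trans (sum-cong-≋ (λ j → ×-homo-+ (v j) (a j) (a′ j))) (∑-distrib-+ (λ j → a j · v j) (λ j → a′ j · v j))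

  linℕ-× : ∀ {k} m (a : Fin k → ℕ) v → m · linℕ a v ≈ linℕ (λ j → m * a j) v
  linℕ-× m a v = trans (IsEndomorphism.sum-homo (×-endomorphism m) (λ j → a j · v j))
                       (sum-cong-≋ (λ j → ×-assocˡ (v j) m (a j)))

  linℕ-homo : ∀ {φ} → IsEndomorphism φ → ∀ {k} (a : Fin k → ℕ) v → φ (linℕ a v) ≈ linℕ a (φ ∘ v)
  linℕ-homo endo a v = trans (sum-homo (λ j → a j · v j)) (sum-cong-≋ (λ j → ×-homo (a j) (v j)))
    where open IsEndomorphism endo

  linℕ-zero : ∀ {k} (v : Fin k → Carrier) → linℕ (λ _ → 0) v ≈ ε
  linℕ-zero v = sum-ε (λ j → 0 · v j) (λ _ → refl)

  linℕ-unit : ∀ {k} (v : Fin k → Carrier) l → linℕ (λ j → indicator (j ≟ᶠ l)) v ≈ v l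
  linℕ-unit {suc k} v zero    = trans (∙-cong (×-homo-1 (v zero)) (sum-ε {k} _ (λ j → refl))) (identityʳ (v zero))
  linℕ-unit {suc k} v (suc l) = trans (identityˡ _) (linℕ-unit (v ∘ suc) l)

  ∑ℕ-× : ∀ {k} (f : Fin k → ℕ) x → ∑ℕ f · x ≈ sum (λ i → f i · x)
  ∑ℕ-× {zero}  f x = refl
  ∑ℕ-× {suc k} f x = trans (×-homo-+ x (f zero) (∑ℕ (f ∘ suc))) (∙-congˡ (∑ℕ-× (f ∘ suc) x))

  linℕ-linℕ : ∀ {m k} (a : Fin m → ℕ) (b : Fin k → Fin m → ℕ) (v : Fin k → Carrier) →
              linℕ a (λ l → linℕ (λ r → b r l) v) ≈ linℕ (λ r → ∑ℕ (λ l → a l * b r l)) v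
  linℕ-linℕ a b v = begin
    sum (λ l → a l · sum (λ r → b r l · v r))     ≈⟨ sum-cong-≋ (λ l → IsEndomorphism.sum-homo (×-endomorphism (a l)) (λ r → b r l · v r)) ⟩
    sum (λ l → sum (λ r → a l · (b r l · v r)))   ≈⟨ ∑-comm (λ l r → a l · (b r l · v r)) ⟩
    sum (λ r → sum (λ l → a l · (b r l · v r)))   ≈⟨ sum-cong-≋ (λ r → sum-cong-≋ (λ l → ×-assocˡ (v r) (a l) (b r l))) ⟩
    sum (λ r → sum (λ l → (a l * b r l) · v r))   ≈⟨ sum-cong-≋ (λ r → ∑ℕ-× (λ l → a l * b r l) (v r)) ⟨
    sum (λ r → ∑ℕ (λ l → a l * b r l) · v r)      ∎

  ×-mod : ∀ n {x} → Torsion p x → n · x ≈ (n % p) · x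
  ×-mod n {x} px≈ε = begin
    n · x                            ≡⟨ ≡.cong (_· x) (m≡m%n+[m/n]*n n p) ⟩
    (n % p + n / p * p) · x          ≈⟨ ×-homo-+ x (n % p) (n / p * p) ⟩
    (n % p) · x ∙ (n / p * p) · x    ≈⟨ ∙-congˡ (×-assocˡ x (n / p) p) ⟨
    (n % p) · x ∙ (n / p) · (p · x)  ≈⟨ ∙-congˡ (trans (×-congʳ (n / p) px≈ε) (IsEndomorphism.ε-homo (×-endomorphism (n / p)))) ⟩
    (n % p) · x ∙ ε                  ≈⟨ identityʳ _ ⟩
    (n % p) · x                      ∎

  reduce : ℕ → Fin p
  reduce n = fromℕ< (m%n<n n p)

  toℕ-reduce : ∀ n → toℕ (reduce n) ≡.≡ n % p
  toℕ-reduce n = toℕ-fromℕ< (m%n<n n p)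

  linℕ-reduce : ∀ {k} (a : Fin k → ℕ) (v : Fin k → Carrier) → (∀ j → Torsion p (v j)) → linℕ a v ≈ lin M (reduce ∘ a) v
  linℕ-reduce a v pv≈ε = sum-cong-≋ (λ j → trans (×-mod (a j) (pv≈ε j)) (reflexive (≡.cong (_· v j) (≡.sym (toℕ-reduce (a j))))))

  Independent : ∀ {k} → (Fin k → Carrier) → Set ℓ
  Independent {k} v = ∀ (a a′ : Fin k → Fin p) → lin M a v ≈ lin M a′ v → ∀ j → a j ≡.≡ a′ j

  independentℕ : ∀ {k} {v : Fin k → Carrier} → (∀ j → Torsion p (v j)) → Independent v →
                 ∀ (a a′ : Fin k → ℕ) → linℕ a v ≈ linℕ a′ v → ∀ j → a j % p ≡.≡ a′ j % p
  independentℕ {v = v} pv≈ε indep a a′ eq j =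
    ≡.trans (≡.sym (toℕ-reduce (a j)))
            (≡.trans (≡.cong toℕ (indep (reduce ∘ a) (reduce ∘ a′) (trans (sym (linℕ-reduce a v pv≈ε)) (trans eq (linℕ-reduce a′ v pv≈ε))) j))
                     (toℕ-reduce (a′ j)))

  record Subspace {h} (W : Pred Carrier h) : Set (c ⊔ ℓ ⊔ h) where
    field
      subgroup : Subgroup W
      killed   : ∀ {x} → W x → Torsion p x
    open Subgroup subgroup public

  record BasisOf {h} (W : Pred Carrier h) (d : ℕ) : Set (c ⊔ ℓ ⊔ h) where
    field
      vec   : Fin d → Carrier
      ∈W    : ∀ j → W (vec j)
      span  : ∀ x → W x → Σ (Fin d → Fin p) λ a → x ≈ lin M a vec
      indep : Independent vec

  order-basis : ∀ {h} {W : Pred Carrier h} {d} (V : Subspace W) → BasisOf W d → Subspace.order V ≡.≡ p ^ d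
  order-basis {W = W} {d} V B = ≡.trans
    (count-bijection (dec ∘ from) (λ _ → yes tt) coordinates combination (λ _ _ → tt) (λ n _ → combination-∈ n)
                     combination-coordinates coordinates-combination)
    (count-all {P = λ _ → ⊤} (λ _ → yes tt) (λ _ → tt))
    where
    open Subspace V
    open BasisOf B
    coordinates : Fin card → Fin (p ^ d)
    coordinates i with dec (from i)
    ... | yes w = funToFin (proj₁ (span (from i) w))
    ... | no _  = funToFin {d} {p} (λ _ → zero)
    combination : Fin (p ^ d) → Fin card
    combination n = to (lin M (finToFun n) vec)
    combination-∈ : ∀ n → W (from (combination n))
    combination-∈ n = resp (sym (from-to _)) (sum-closed _ (λ j → ×-closed (toℕ (finToFun n j)) (∈W j)))
    combination-coordinates : ∀ i → W (from i) → combination (coordinates i) ≡.≡ i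
    combination-coordinates i w with dec (from i)
    ... | no ¬w = contradiction w ¬w
    ... | yes w′ = ≡.trans (to-cong (trans (linℕ-cong (λ j → ≡.cong toℕ (finToFun-funToFin (proj₁ (span (from i) w′)) j)) (λ _ → refl))
                                           (sym (proj₂ (span (from i) w′)))))
                           (to-from i)
    coordinates-combination : ∀ n → ⊤ → coordinates (combination n) ≡.≡ n
    coordinates-combination n _ with dec (from (combination n))
    ... | no ¬w = contradiction (combination-∈ n) ¬w
    ... | yes w = ≡.trans (Counting.funToFin-cong (indep _ (finToFun n) (trans (sym (proj₂ (span _ w))) (from-to _))))
                          (funToFin-finToFin {d} {p} n)

  module _ {h} {W : Pred Carrier h} (V : Subspace W) where
    open Subspace V

    ⁻¹≈×-pred : ∀ {x} → Torsion p x → x ⁻¹ ≈ (p ∸ 1) · x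
    ⁻¹≈×-pred {x} px≈ε = sym (inverseʳ-unique x ((p ∸ 1) · x) (trans (∙-congʳ (sym (×-homo-1 x))) (trans (sym (×-homo-+ x 1 (p ∸ 1))) px≈ε)))

    Spanned : ∀ {k} → (Fin k → Carrier) → Carrier → Set ℓ
    Spanned v x = ∃ λ a → x ≈ linℕ a v

    module Span {k} {v : Fin k → Carrier} (v∈W : ∀ j → W (v j)) where
      spanned-resp : ∀ {x y} → x ≈ y → Spanned v x → Spanned v y
      spanned-resp x≈y (a , x≈av) = a , trans (sym x≈y) x≈av

      spanned-∈ : ∀ {x} → Spanned v x → W x
      spanned-∈ (a , x≈av) = resp (sym x≈av) (sum-closed _ (λ j → ×-closed (a j) (v∈W j)))

      spanned-∙ : ∀ {x y} → Spanned v x → Spanned v y → Spanned v (x ∙ y)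
      spanned-∙ (a , x≈av) (b , y≈bv) = (λ j → a j + b j) , trans (∙-cong x≈av y≈bv) (sym (linℕ-+ a b v))

      spanned-× : ∀ n {x} → Spanned v x → Spanned v (n · x)
      spanned-× n (a , x≈av) = (λ j → n * a j) , trans (×-congʳ n x≈av) (linℕ-× n a v)

      spanned-⁻¹ : ∀ {x} → Spanned v x → Spanned v (x ⁻¹)
      spanned-⁻¹ x∈ = spanned-resp (sym (⁻¹≈×-pred (killed (spanned-∈ x∈)))) (spanned-× (p ∸ 1) x∈)

      reduced : ∀ {x} → Spanned v x → Σ (Fin k → Fin p) λ a → x ≈ lin M a v
      reduced (a , x≈av) = reduce ∘ a , trans x≈av (linℕ-reduce a v (killed ∘ v∈W))

      spanned? : ∀ x → Dec (Σ (Fin k → Fin p) λ a → x ≈ lin M a v)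
      spanned? x = map′ (λ (n , x≈) → finToFun n , x≈)
                        (λ (a , x≈) → funToFin a , trans x≈ (linℕ-cong (λ j → ≡.cong toℕ (≡.sym (finToFun-funToFin a j))) (λ _ → refl)))
                        (any? (λ n → x ≈? lin M (finToFun n) v))

      -- δ is invertible modulo p: Bézout gives y with y δ ≡ ±1 (mod p)
      spanned-cancel : Prime p → ∀ δ {u} → 0 < δ → δ < p → Torsion p u → Spanned v (δ · u) → Spanned v u
      spanned-cancel prime δ@(suc _) {u} _ δ<p pu≈ε δu∈ with coprime-Bézout (prime⇒coprime prime δ<p)
      ... | Bézout.+- x y 1+yδ≡xp = spanned-resp (sym (inverseˡ-unique u (y · (δ · u)) (begin
          u ∙ y · (δ · u)  ≈⟨ ∙-congˡ (×-assocˡ u y δ) ⟩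
          (1 + y * δ) · u  ≡⟨ ≡.cong (_· u) 1+yδ≡xp ⟩
          (x * p) · u      ≈⟨ ×-assocˡ u x p ⟨
          x · (p · u)      ≈⟨ trans (×-congʳ x pu≈ε) (IsEndomorphism.ε-homo (×-endomorphism x)) ⟩
          ε                ∎)))
        (spanned-⁻¹ (spanned-× y δu∈))
      ... | Bézout.-+ x y 1+xp≡yδ = spanned-resp (begin
          y · (δ · u)      ≈⟨ ×-assocˡ u y δ ⟩
          (y * δ) · u      ≡⟨ ≡.cong (_· u) 1+xp≡yδ ⟨
          u ∙ (x * p) · u  ≈⟨ ∙-congˡ (×-assocˡ u x p) ⟨
          u ∙ x · (p · u)  ≈⟨ ∙-congˡ (trans (×-congʳ x pu≈ε) (IsEndomorphism.ε-homo (×-endomorphism x))) ⟩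
          u ∙ ε            ≈⟨ identityʳ u ⟩
          u                ∎)
        (spanned-× y δu∈)

    record IndependentFamily : Set (c ⊔ ℓ ⊔ h) where
      field
        length : ℕ
        vec    : Fin length → Carrier
        ∈W     : ∀ j → W (vec j)
        indep  : Independent vec

    module Extend (prime : Prime p) (F : IndependentFamily) {u} (u∈W : W u)
                  (u∉ : ¬ (Σ (Fin (IndependentFamily.length F) → Fin p) λ a → u ≈ lin M a (IndependentFamily.vec F))) where
      open IndependentFamily F
      open Span ∈W

      distinct-heads : ∀ a b {L L′} → a < b → b < p → Spanned vec L → Spanned vec L′ → a · u ∙ L ≈ b · u ∙ L′ → ⊥
      distinct-heads a b {L} {L′} a<b b<p L∈ L′∈ eq = u∉ (reduced (spanned-cancel prime δ 0<δ δ<p (killed u∈W) δu∈))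
        where
        δ = b ∸ a
        0<δ : 0 < δ
        0<δ = ℕ.m<n⇒0<n∸m a<b
        δ<p : δ < p
        δ<p = ℕ.≤-<-trans (ℕ.m∸n≤m b a) b<p
        cancelled : L ≈ δ · u ∙ L′
        cancelled = ∙-cancelˡ (a · u) L (δ · u ∙ L′) (begin
          a · u ∙ L          ≈⟨ eq ⟩
          b · u ∙ L′         ≡⟨ ≡.cong (λ n → n · u ∙ L′) (ℕ.m+[n∸m]≡n (ℕ.<⇒≤ a<b)) ⟨
          (a + δ) · u ∙ L′   ≈⟨ ∙-congʳ (×-homo-+ u a δ) ⟩
          a · u ∙ δ · u ∙ L′ ≈⟨ assoc (a · u) (δ · u) L′ ⟩
          a · u ∙ (δ · u ∙ L′) ∎)
        δu∈ : Spanned vec (δ · u)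
        δu∈ = spanned-resp (trans (∙-congʳ cancelled) (//-rightDividesʳ L′ (δ · u))) (spanned-∙ L∈ (spanned-⁻¹ L′∈))

      same-head : ∀ (a b : Fin p) {L L′} → Spanned vec L → Spanned vec L′ → toℕ a · u ∙ L ≈ toℕ b · u ∙ L′ → a ≡.≡ b
      same-head a b L∈ L′∈ eq with ℕ.<-cmp (toℕ a) (toℕ b)
      ... | tri< a<b _ _ = ⊥-elim (distinct-heads (toℕ a) (toℕ b) a<b (toℕ<n b) L∈ L′∈ eq)
      ... | tri≈ _ a≡b _ = toℕ-injective a≡b
      ... | tri> _ _ b<a = ⊥-elim (distinct-heads (toℕ b) (toℕ a) b<a (toℕ<n a) L′∈ L∈ (sym eq))

      extended-indep : Independent (u ∷ vec)
      extended-indep a a′ eq zero    = same-head (a zero) (a′ zero) (toℕ ∘ a ∘ suc , refl) (toℕ ∘ a′ ∘ suc , refl) eq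
      extended-indep a a′ eq (suc j) = indep (a ∘ suc) (a′ ∘ suc) tails-equal j
        where
        tails-equal : lin M (a ∘ suc) vec ≈ lin M (a′ ∘ suc) vec
        tails-equal = ∙-cancelˡ (toℕ (a zero) · u) _ _
                        (trans eq (∙-congʳ (reflexive (≡.cong (λ b → toℕ b · u) (≡.sym (extended-indep a a′ eq zero))))))

      extended : IndependentFamily
      extended = record
        { length = suc length
        ; vec    = u ∷ vec
        ; ∈W     = λ { zero → u∈W ; (suc j) → ∈W j }
        ; indep  = extended-indep
        }

      spanned-extended : ∀ {x} → Spanned vec x → Spanned (u ∷ vec) x
      spanned-extended (a , x≈av) = 0 ∷ a , trans x≈av (sym (identityˡ _))

      spanned-new : Spanned (u ∷ vec) u
      spanned-new = 1 ∷ (λ _ → 0) , sym (trans (∙-cong (×-homo-1 u) (linℕ-zero vec)) (identityʳ u))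

    Covers : ∀ {m} → (Fin m → Carrier) → IndependentFamily → Set (h ⊔ ℓ)
    Covers cand F = ∀ t → W (cand t) → Spanned (IndependentFamily.vec F) (cand t)

    greedy : Prime p → ∀ {m} (cand : Fin m → Carrier) → Σ IndependentFamily (Covers cand)
    greedy prime {zero} cand = record { length = 0 ; vec = λ () ; ∈W = λ () ; indep = λ _ _ _ () } , λ ()
    greedy prime {suc m} cand with greedy prime (cand ∘ suc)
    ... | F , covers with dec (cand zero)
    ...   | no c₀∉W = F , λ { zero c₀∈W → contradiction c₀∈W c₀∉W ; (suc t) → covers t }
    ...   | yes c₀∈W with Span.spanned? (IndependentFamily.∈W F) (cand zero)
    ...     | yes (a , c₀≈) = F , λ { zero _ → toℕ ∘ a , c₀≈ ; (suc t) → covers t }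
    ...     | no c₀∉ = Extend.extended prime F c₀∈W c₀∉ , λ
                { zero _ → Extend.spanned-new prime F c₀∈W c₀∉
                ; (suc t) ct∈W → Extend.spanned-extended prime F c₀∈W c₀∉ (covers t ct∈W) }

    basis : Prime p → Σ ℕ (BasisOf W)
    basis prime = length , record
      { vec   = vec
      ; ∈W    = ∈W
      ; span  = λ x x∈W → reduced (spanned-resp (from-to x) (covers (to x) (resp (sym (from-to x)) x∈W)))
      ; indep = indep
      }
      where
      F = proj₁ (greedy prime from)
      covers = proj₂ (greedy prime from)
      open IndependentFamily F
      open Span ∈W

module Involution {c ℓ} (M : FiniteAbelianGroup c ℓ) (σ : FiniteAbelianGroup.Carrier M → FiniteAbelianGroup.Carrier M)
                  (aut : IsAut M σ) (σσ≈id : ∀ x → FiniteAbelianGroup._≈_ M (σ (σ x)) x) where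
  open import Data.Nat.Base using (_+_; _*_)
  import Data.Nat.Properties as ℕ
  open import Data.Product using (_,_)
  open import Level using (Level; _⊔_)
  import Algebra.Morphism.Structures as Morphisms
  import Relation.Binary.PropositionalEquality as ≡
  open import Relation.Unary using (Pred)
  open FiniteGroup M
  open Subgroup using (order; dec; resp)
  open import Relation.Binary.Reasoning.Setoid setoid

  private
    variable
      a : Level
    module σ = Morphisms.GroupMorphisms.IsGroupIsomorphism aut

  σ-endomorphism : IsEndomorphism σ
  σ-endomorphism = record { cong = σ.⟦⟧-cong ; ∙-homo = σ.∙-homo }

  Stable : Pred Carrier a → Set (c ⊔ a)
  Stable H = ∀ {x} → H x → H (σ x)

  Fixed : Pred Carrier ℓ
  Fixed x = σ x ≈ x

  Negated : Pred Carrier ℓ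
  Negated x = σ x ≈ x ⁻¹

  fixed : Subgroup Fixed
  fixed = record
    { dec       = λ x → σ x ≈? x
    ; resp      = λ x≈y σx≈x → trans (σ.⟦⟧-cong (sym x≈y)) (trans σx≈x x≈y)
    ; ε-closed  = σ.ε-homo
    ; ∙-closed  = λ {x} {y} σx≈x σy≈y → trans (σ.∙-homo x y) (∙-cong σx≈x σy≈y)
    ; ⁻¹-closed = λ {x} σx≈x → trans (σ.⁻¹-homo x) (⁻¹-cong σx≈x)
    }

  negated : Subgroup Negated
  negated = record
    { dec       = λ x → σ x ≈? x ⁻¹
    ; resp      = λ x≈y σx≈x⁻¹ → trans (σ.⟦⟧-cong (sym x≈y)) (trans σx≈x⁻¹ (⁻¹-cong x≈y))
    ; ε-closed  = trans σ.ε-homo (sym ε⁻¹≈ε)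
    ; ∙-closed  = λ {x} {y} σx≈x⁻¹ σy≈y⁻¹ → trans (σ.∙-homo x y) (trans (∙-cong σx≈x⁻¹ σy≈y⁻¹) (⁻¹-∙-comm x y))
    ; ⁻¹-closed = λ {x} σx≈x⁻¹ → trans (σ.⁻¹-homo x) (⁻¹-cong σx≈x⁻¹)
    }

  module Projections (h : ℕ) (2h≈1 : ∀ x → (h + h) · x ≈ x) where
    open import Algebra.Properties.CommutativeSemigroup commutativeSemigroup using (interchange)

    π⁺ π⁻ : Carrier → Carrier
    π⁺ x = h · (x ∙ σ x)
    π⁻ x = h · (x ∙ σ x ⁻¹)

    π⁻-endomorphism : IsEndomorphism π⁻
    π⁻-endomorphism = record
      { cong   = λ x≈y → ×-congʳ h (∙-cong x≈y (⁻¹-cong (σ.⟦⟧-cong x≈y)))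
      ; ∙-homo = λ x y → begin
          h · (x ∙ y ∙ σ (x ∙ y) ⁻¹)           ≈⟨ ×-congʳ h (∙-congˡ (trans (⁻¹-cong (σ.∙-homo x y)) (sym (⁻¹-∙-comm (σ x) (σ y))))) ⟩
          h · (x ∙ y ∙ (σ x ⁻¹ ∙ σ y ⁻¹))      ≈⟨ ×-congʳ h (interchange x y (σ x ⁻¹) (σ y ⁻¹)) ⟩
          h · (x ∙ σ x ⁻¹ ∙ (y ∙ σ y ⁻¹))      ≈⟨ ×-distrib-+ (x ∙ σ x ⁻¹) (y ∙ σ y ⁻¹) h ⟩
          π⁻ x ∙ π⁻ y                          ∎
      }

    π⁺∙π⁻ : ∀ x → π⁺ x ∙ π⁻ x ≈ x
    π⁺∙π⁻ x = begin
      h · (x ∙ σ x) ∙ h · (x ∙ σ x ⁻¹)      ≈⟨ ×-distrib-+ (x ∙ σ x) (x ∙ σ x ⁻¹) h ⟨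
      h · (x ∙ σ x ∙ (x ∙ σ x ⁻¹))          ≈⟨ ×-congʳ h (interchange x (σ x) x (σ x ⁻¹)) ⟩
      h · (x ∙ x ∙ (σ x ∙ σ x ⁻¹))          ≈⟨ ×-congʳ h (trans (∙-congˡ (inverseʳ (σ x))) (identityʳ (x ∙ x))) ⟩
      h · (x ∙ x)                           ≈⟨ ×-congʳ h (∙-congˡ (identityʳ x)) ⟨
      h · 2 · x                             ≈⟨ ×-assocˡ x h 2 ⟩
      (h * 2) · x                           ≡⟨ ≡.cong (_· x) (≡.trans (ℕ.*-comm h 2) (≡.cong (h +_) (ℕ.+-identityʳ h))) ⟩
      (h + h) · x                           ≈⟨ 2h≈1 x ⟩
      x                                     ∎

    π⁺-fixed : ∀ x → Fixed (π⁺ x)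
    π⁺-fixed x = trans (IsEndomorphism.×-homo σ-endomorphism h (x ∙ σ x))
                       (×-congʳ h (trans (σ.∙-homo x (σ x)) (trans (∙-congˡ (σσ≈id x)) (comm (σ x) x))))

    π⁻-negated : ∀ x → Negated (π⁻ x)
    π⁻-negated x = begin
      σ (h · (x ∙ σ x ⁻¹))       ≈⟨ IsEndomorphism.×-homo σ-endomorphism h (x ∙ σ x ⁻¹) ⟩
      h · σ (x ∙ σ x ⁻¹)         ≈⟨ ×-congʳ h (trans (σ.∙-homo x (σ x ⁻¹)) (∙-congˡ (trans (σ.⁻¹-homo (σ x)) (⁻¹-cong (σσ≈id x))))) ⟩
      h · (σ x ∙ x ⁻¹)           ≈⟨ ×-congʳ h (trans (comm (σ x) (x ⁻¹)) (∙-congˡ (sym (⁻¹-involutive (σ x))))) ⟩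
      h · (x ⁻¹ ∙ σ x ⁻¹ ⁻¹)     ≈⟨ ×-congʳ h (⁻¹-∙-comm x (σ x ⁻¹)) ⟩
      h · ((x ∙ σ x ⁻¹) ⁻¹)      ≈⟨ IsEndomorphism.⁻¹-homo (×-endomorphism h) (x ∙ σ x ⁻¹) ⟩
      (h · (x ∙ σ x ⁻¹)) ⁻¹      ∎

    π⁺-negated : ∀ {x} → Negated x → π⁺ x ≈ ε
    π⁺-negated {x} σx≈x⁻¹ = trans (×-congʳ h (trans (∙-congˡ σx≈x⁻¹) (inverseʳ x))) (IsEndomorphism.ε-homo (×-endomorphism h))

    π⁻-fixed : ∀ {x} → Fixed x → π⁻ x ≈ ε
    π⁻-fixed {x} σx≈x = trans (×-congʳ h (trans (∙-congˡ (⁻¹-cong σx≈x)) (inverseʳ x))) (IsEndomorphism.ε-homo (×-endomorphism h))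

    π⁻-on-negated : ∀ {x} → Negated x → π⁻ x ≈ x
    π⁻-on-negated {x} σx≈x⁻¹ = trans (sym (identityˡ (π⁻ x))) (trans (∙-congʳ (sym (π⁺-negated σx≈x⁻¹))) (π⁺∙π⁻ x))

    module _ {H : Pred Carrier a} (S : Subgroup H) (stable : Stable H) where
      open Subgroup S using (∙-closed; ⁻¹-closed; ×-closed)

      π⁺-closed : ∀ {x} → H x → H (π⁺ x)
      π⁺-closed Hx = ×-closed h (∙-closed Hx (stable Hx))

      π⁻-closed : ∀ {x} → H x → H (π⁻ x)
      π⁻-closed Hx = ×-closed h (∙-closed Hx (⁻¹-closed (stable Hx)))

      order-split : order S ≡.≡ order (S ∩ˢ fixed) * order (S ∩ˢ negated)
      order-split = order-by-kernel π⁻-endomorphism S (dec (S ∩ˢ fixed)) (dec (S ∩ˢ negated)) (resp (S ∩ˢ negated))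
        (λ {x} Hx → π⁻-closed Hx , π⁻-negated x)
        (λ {y} (Hy , σy≈y⁻¹) → y , Hy , π⁻-on-negated σy≈y⁻¹)
        (λ (Hx , σx≈x) → Hx , π⁻-fixed σx≈x)
        (λ {x} Hx π⁻x≈ε → Hx , fixed-part x π⁻x≈ε)
        where
        fixed-part : ∀ x → π⁻ x ≈ ε → Fixed x
        fixed-part x π⁻x≈ε = Subgroup.resp fixed x≈π⁺x (π⁺-fixed x)
          where
          x≈π⁺x : π⁺ x ≈ x
          x≈π⁺x = trans (sym (identityʳ (π⁺ x))) (trans (∙-congˡ (sym π⁻x≈ε)) (π⁺∙π⁻ x))

module InvolutionDeterminant {c ℓ} (M : FiniteAbelianGroup c ℓ) (q : ℕ)
                             (σ : FiniteAbelianGroup.Carrier M → FiniteAbelianGroup.Carrier M)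
                             (aut : IsAut M σ) (σσ≈id : ∀ x → FiniteAbelianGroup._≈_ M (σ (σ x)) x)
                             (h : ℕ) (2h≈1 : ∀ x → FiniteAbelianGroup._≈_ M (FiniteAbelianGroup._·_ M (h Nat.+ h) x) x) where
  open import Data.Nat.Base using (suc; _+_; _*_; _∸_; _%_; _^_)
  import Data.Nat.Properties as ℕ
  open import Algebra.Properties.Semiring.Sum ℕ.+-*-semiring using () renaming (sum to ∑ℕ)
  open import Data.Fin.Base using (Fin; toℕ; splitAt; _↑ˡ_; _↑ʳ_)
  open import Data.Fin.Properties using (splitAt⁻¹-↑ˡ; splitAt⁻¹-↑ʳ) renaming (_≟_ to _≟ᶠ_)
  open import Data.Integer.Base using (ℤ; +_; 1ℤ; -1ℤ) renaming (_*_ to _*ℤ_)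
  import Data.Integer.Properties as ℤ
  open import Data.Integer.Divisibility.Signed using (divides)
  open import Data.Product using (_,_; proj₁; proj₂)
  open import Data.Nat.Primality using (Prime)
  open import Data.Sum.Base using (inj₁; inj₂)
  open import Data.Vec.Functional using (_++_)
  open import Data.Vec.Functional.Properties using (lookup-++ˡ; lookup-++ʳ)
  open import Function using (_∘_; const)
  import Relation.Binary.PropositionalEquality as ≡
  open import Relation.Unary using (Pred; _∩_)
  open import Defs using (lin; negOnePowℕ; detℤ)
  open Congruence
  open Determinant using (Matrix; δ; I; _⊗_; diagonal; ⊗-diagonal; signs; ∏-signs; det-diagonal; δ-diag; δ-off)
  open DeterminantModulo using (det-conjugate-mod)
  open FiniteGroup M
  open ElementaryAbelian M q
  open Involution M σ aut σσ≈id
  open Projections h 2h≈1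
  open Counting using (indicator)
  open import Relation.Nullary using (yes; no)

  ↑-elim : ∀ {a} m {n} {P : Fin (m + n) → Set a} → (∀ i → P (i ↑ˡ n)) → (∀ i → P (m ↑ʳ i)) → ∀ j → P j
  ↑-elim m {P = P} left right j with splitAt m j in eq
  ... | inj₁ i = ≡.subst P (splitAt⁻¹-↑ˡ eq) (left i)
  ... | inj₂ i = ≡.subst P (splitAt⁻¹-↑ʳ eq) (right i)

  indicator≡δ : ∀ {n} (k l : Fin n) → + indicator (k ≟ᶠ l) ≡.≡ δ k l
  indicator≡δ k l with k ≟ᶠ l
  ... | yes ≡.refl = ≡.sym (δ-diag k)
  ... | no k≢l     = ≡.sym (δ-off k≢l)

  module Adapted {w} {W : Pred Carrier w} (V : Subspace W) (stable : Stable W) {a e : ℕ}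
                 (B⁺ : BasisOf (W ∩ Fixed) a) (B⁻ : BasisOf (W ∩ Negated) e) (b : BasisOf W (a + e))
                 (A : Fin (a + e) → Fin (a + e) → Fin p)
                 (A-matrix : ∀ j → σ (BasisOf.vec b j) ≈ lin M (λ k → A k j) (BasisOf.vec b)) where
    open Subspace V
    private
      module b = BasisOf b
      module B⁺ = BasisOf B⁺
      module B⁻ = BasisOf B⁻

    adapted : Fin (a + e) → Carrier
    adapted = _++_ {m = a} B⁺.vec B⁻.vec

    eigenvalue : Fin (a + e) → ℕ
    eigenvalue = _++_ {m = a} (const 1) (const (p ∸ 1))

    adapted-∈ : ∀ j → W (adapted j)
    adapted-∈ = ↑-elim a (λ i → ≡.subst W (≡.sym (lookup-++ˡ B⁺.vec B⁻.vec i)) (proj₁ (B⁺.∈W i)))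
                         (λ i → ≡.subst W (≡.sym (lookup-++ʳ B⁺.vec B⁻.vec i)) (proj₁ (B⁻.∈W i)))

    σ-adapted : ∀ j → σ (adapted j) ≈ eigenvalue j · adapted j
    σ-adapted = ↑-elim a {P = λ j → σ (adapted j) ≈ eigenvalue j · adapted j}
      (λ i → ≡.subst₂ (λ x n → σ x ≈ n · x) (≡.sym (lookup-++ˡ B⁺.vec B⁻.vec i)) (≡.sym (lookup-++ˡ {m = a} {n = e} (const 1) (const (p ∸ 1)) i))
                      (trans (proj₂ (B⁺.∈W i)) (sym (×-homo-1 (B⁺.vec i)))))
      (λ i → ≡.subst₂ (λ x n → σ x ≈ n · x) (≡.sym (lookup-++ʳ B⁺.vec B⁻.vec i)) (≡.sym (lookup-++ʳ {m = a} {n = e} (const 1) (const (p ∸ 1)) i))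
                      (trans (proj₂ (B⁻.∈W i)) (⁻¹≈×-pred V (killed (proj₁ (B⁻.∈W i))))))

    eigenvalue≡signs : ∀ j → + eigenvalue j ≡ signs a e j mod + p
    eigenvalue≡signs = ↑-elim a {P = λ j → + eigenvalue j ≡ signs a e j mod + p}
      (λ i → ≡.subst₂ (λ n s → + n ≡ s mod + p) (≡.sym (lookup-++ˡ {m = a} {n = e} (const 1) (const (p ∸ 1)) i))
                      (≡.sym (lookup-++ˡ {m = a} {n = e} (const 1ℤ) (const -1ℤ) i)) (≡⇒≡-mod ≡.refl))
      (λ i → ≡.subst₂ (λ n s → + n ≡ s mod + p) (≡.sym (lookup-++ʳ {m = a} {n = e} (const 1) (const (p ∸ 1)) i))
                      (≡.sym (lookup-++ʳ {m = a} {n = e} (const 1ℤ) (const -1ℤ) i)) p-1≡-1)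
      where
      p-1≡-1 : + (p ∸ 1) ≡ -1ℤ mod + p
      p-1≡-1 = ≡-mod (divides 1ℤ (≡.trans (≡.sym (ℤ.pos-+ (suc q) 1))
                                         (≡.trans (≡.cong +_ (ℕ.+-comm (suc q) 1)) (≡.sym (ℤ.*-identityˡ (+ p))))))

    -- P and Q are the change-of-basis matrices between b and the eigenbasis; they are
    -- mutually inverse modulo p
    P : Fin (a + e) → Fin (a + e) → ℕ
    P k j = toℕ (proj₁ (b.span (adapted j) (adapted-∈ j)) k)

    adapted≈ : ∀ j → adapted j ≈ linℕ (λ k → P k j) b.vec
    adapted≈ j = proj₂ (b.span (adapted j) (adapted-∈ j))

    adapted-coordinates : ∀ x → W x → Fin (a + e) → Fin p
    adapted-coordinates x x∈W = _++_ {m = a} (proj₁ (B⁺.span (π⁺ x) (π⁺-closed subgroup stable x∈W , π⁺-fixed x)))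
                                             (proj₁ (B⁻.span (π⁻ x) (π⁻-closed subgroup stable x∈W , π⁻-negated x)))

    adapted-span : ∀ x (x∈W : W x) → x ≈ lin M (adapted-coordinates x x∈W) adapted
    adapted-span x x∈W = sym (begin
      lin M co adapted                                                          ≈⟨ sum-↑ a (λ j → toℕ (co j) · adapted j) ⟩
      sum (λ i → toℕ (co (i ↑ˡ e)) · adapted (i ↑ˡ e)) ∙ sum (λ i → toℕ (co (a ↑ʳ i)) · adapted (a ↑ʳ i))
        ≈⟨ ∙-cong (sum-cong-≋ (λ i → reflexive (≡.cong₂ (λ n y → toℕ n · y) (lookup-++ˡ co⁺ co⁻ i) (lookup-++ˡ B⁺.vec B⁻.vec i))))
                  (sum-cong-≋ (λ i → reflexive (≡.cong₂ (λ n y → toℕ n · y) (lookup-++ʳ co⁺ co⁻ i) (lookup-++ʳ B⁺.vec B⁻.vec i)))) ⟩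
      lin M co⁺ B⁺.vec ∙ lin M co⁻ B⁻.vec                                      ≈⟨ ∙-cong (sym (proj₂ span⁺)) (sym (proj₂ span⁻)) ⟩
      π⁺ x ∙ π⁻ x                                                               ≈⟨ π⁺∙π⁻ x ⟩
      x                                                                         ∎)
      where
      span⁺ = B⁺.span (π⁺ x) (π⁺-closed subgroup stable x∈W , π⁺-fixed x)
      span⁻ = B⁻.span (π⁻ x) (π⁻-closed subgroup stable x∈W , π⁻-negated x)
      co⁺ = proj₁ span⁺
      co⁻ = proj₁ span⁻
      co = adapted-coordinates x x∈W
      open import Relation.Binary.Reasoning.Setoid setoid

    Q : Fin (a + e) → Fin (a + e) → ℕ
    Q j l = toℕ (adapted-coordinates (b.vec l) (b.∈W l) j)

    QP≡I : ∀ k l → ∑ℕ (λ j → Q j l * P k j) % p ≡.≡ indicator (k ≟ᶠ l) % p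
    QP≡I k l = independentℕ (killed ∘ b.∈W) b.indep (λ k → ∑ℕ (λ j → Q j l * P k j)) (λ k → indicator (k ≟ᶠ l)) (begin
      linℕ (λ k → ∑ℕ (λ j → Q j l * P k j)) b.vec        ≈⟨ linℕ-linℕ (λ j → Q j l) P b.vec ⟨
      linℕ (λ j → Q j l) (λ j → linℕ (λ k → P k j) b.vec) ≈⟨ linℕ-congʳ (λ j → Q j l) (sym ∘ adapted≈) ⟩
      linℕ (λ j → Q j l) adapted                           ≈⟨ adapted-span (b.vec l) (b.∈W l) ⟨
      b.vec l                                              ≈⟨ linℕ-unit b.vec l ⟨
      linℕ (λ k → indicator (k ≟ᶠ l)) b.vec                ∎) k
      where open import Relation.Binary.Reasoning.Setoid setoid

    AP≡PD : ∀ k j → ∑ℕ (λ l → P l j * toℕ (A k l)) % p ≡.≡ (eigenvalue j * P k j) % p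
    AP≡PD k j = independentℕ (killed ∘ b.∈W) b.indep (λ k → ∑ℕ (λ l → P l j * toℕ (A k l))) (λ k → eigenvalue j * P k j) (begin
      linℕ (λ k → ∑ℕ (λ l → P l j * toℕ (A k l))) b.vec          ≈⟨ linℕ-linℕ (λ l → P l j) (λ k l → toℕ (A k l)) b.vec ⟨
      linℕ (λ l → P l j) (λ l → lin M (λ k → A k l) b.vec)       ≈⟨ linℕ-congʳ (λ l → P l j) (sym ∘ A-matrix) ⟩
      linℕ (λ l → P l j) (σ ∘ b.vec)                             ≈⟨ linℕ-homo σ-endomorphism (λ l → P l j) b.vec ⟨
      σ (linℕ (λ l → P l j) b.vec)                               ≈⟨ IsEndomorphism.cong σ-endomorphism (adapted≈ j) ⟨
      σ (adapted j)                                              ≈⟨ σ-adapted j ⟩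
      eigenvalue j · adapted j                                   ≈⟨ ×-congʳ (eigenvalue j) (adapted≈ j) ⟩
      eigenvalue j · linℕ (λ k → P k j) b.vec                    ≈⟨ linℕ-× (eigenvalue j) (λ k → P k j) b.vec ⟩
      linℕ (λ k → eigenvalue j * P k j) b.vec                    ∎) k
      where open import Relation.Binary.Reasoning.Setoid setoid

    Pℤ : Matrix (a + e)
    Pℤ k j = + P k j

    Qℤ : Matrix (a + e)
    Qℤ j l = + Q j l

    Aℤ : Matrix (a + e)
    Aℤ k l = + toℕ (A k l)

    AP≡PD-mod : ∀ k j → (Aℤ ⊗ Pℤ) k j ≡ (Pℤ ⊗ diagonal (signs a e)) k j mod + p
    AP≡PD-mod k j = begin
      (Aℤ ⊗ Pℤ) k j                       ≡⟨ sum-pos-* (λ l → toℕ (A k l)) (λ l → P l j) ⟩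
      + ∑ℕ (λ l → P l j * toℕ (A k l))    ≈⟨ %-≡⇒≡-mod p _ _ (AP≡PD k j) ⟩
      + (eigenvalue j * P k j)            ≡⟨ ℤ.pos-* (eigenvalue j) (P k j) ⟩
      + eigenvalue j *ℤ Pℤ k j            ≈⟨ *-congʳ-mod (Pℤ k j) (eigenvalue≡signs j) ⟩
      signs a e j *ℤ Pℤ k j               ≡⟨ ℤ.*-comm (signs a e j) (Pℤ k j) ⟩
      Pℤ k j *ℤ signs a e j               ≡⟨ ⊗-diagonal Pℤ (signs a e) k j ⟨
      (Pℤ ⊗ diagonal (signs a e)) k j     ∎
      where open ≡-mod-Reasoning (+ p)

    PQ≡I-mod : ∀ k l → (Pℤ ⊗ Qℤ) k l ≡ I k l mod + p
    PQ≡I-mod k l = begin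
      (Pℤ ⊗ Qℤ) k l                ≡⟨ sum-pos-* (λ j → P k j) (λ j → Q j l) ⟩
      + ∑ℕ (λ j → Q j l * P k j)   ≈⟨ %-≡⇒≡-mod p _ _ (QP≡I k l) ⟩
      + indicator (k ≟ᶠ l)         ≡⟨ indicator≡δ k l ⟩
      I k l                        ∎
      where open ≡-mod-Reasoning (+ p)

    det≡signs : detℤ M A ≡ negOnePowℕ e mod + p
    det≡signs = ≡-mod-trans (det-conjugate-mod AP≡PD-mod PQ≡I-mod)
                            (≡⇒≡-mod (≡.trans (det-diagonal (signs a e)) (∏-signs a e)))

  module _ (prime : Prime p) {w} {W : Pred Carrier w} (V : Subspace W) (stable : Stable W) where
    open Subspace V

    fixed-part : Subspace (W ∩ Fixed)
    fixed-part = record { subgroup = subgroup ∩ˢ fixed ; killed = killed ∘ proj₁ }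

    negated-part : Subspace (W ∩ Negated)
    negated-part = record { subgroup = subgroup ∩ˢ negated ; killed = killed ∘ proj₁ }

    dimension-split : ∀ {d a e} → BasisOf W d → BasisOf (W ∩ Fixed) a → BasisOf (W ∩ Negated) e → d ≡.≡ a + e
    dimension-split {d} {a} {e} b B⁺ B⁻ = ≡.trans (≡.sym (ν-pow d)) (≡.trans (≡.cong (ν p) p^d≡p^[a+e]) (ν-pow (a + e)))
      where
      open Valuation q using (ν-pow)
      open Defs using (ν)
      p^d≡p^[a+e] : p ^ d ≡.≡ p ^ (a + e)
      p^d≡p^[a+e] = begin
        p ^ d                                                ≡⟨ order-basis V b ⟨
        order                                                ≡⟨ order-split subgroup stable ⟩
        Subspace.order fixed-part * Subspace.order negated-part ≡⟨ ≡.cong₂ _*_ (order-basis fixed-part B⁺) (order-basis negated-part B⁻) ⟩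
        p ^ a * p ^ e                                        ≡⟨ ℕ.^-distribˡ-+-* p a e ⟨
        p ^ (a + e)                                          ∎
        where open ≡.≡-Reasoning

    det-involution : ∀ {d e} (b : BasisOf W d) (A : Fin d → Fin d → Fin p) →
                     (∀ j → σ (BasisOf.vec b j) ≈ lin M (λ k → A k j) (BasisOf.vec b)) →
                     BasisOf (W ∩ Negated) e → detℤ M A ≡ negOnePowℕ e mod + p
    det-involution {d} {e} b A A-matrix B⁻ = go b A A-matrix (dimension-split b B⁺ B⁻)
      where
      a = proj₁ (basis fixed-part prime)
      B⁺ = proj₂ (basis fixed-part prime)
      go : ∀ {d′} (b : BasisOf W d′) A → (∀ j → σ (BasisOf.vec b j) ≈ lin M (λ k → A k j) (BasisOf.vec b)) →
           d′ ≡.≡ a + e → detℤ M A ≡ negOnePowℕ e mod + p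
      go b A A-matrix ≡.refl = Adapted.det≡signs V stable B⁺ B⁻ b A A-matrix

module OddInvolution {c ℓ} (q : ℕ) (prime : Prime (suc (suc q))) (odd : suc (suc q) ≢ 2) (M : FiniteAbelianGroup c ℓ)
            (σ : FiniteAbelianGroup.Carrier M → FiniteAbelianGroup.Carrier M) (aut : IsAut M σ)
            (σ²≈id : ∀ x → FiniteAbelianGroup._≈_ M (σ (σ x)) x)
            (n : ℕ) (p^n-kills : ∀ x → FiniteAbelianGroup._≈_ M (FiniteAbelianGroup._·_ M (suc (suc q) ^ n) x) (FiniteAbelianGroup.ε M)) where
  open import Data.Nat.Base using (suc; _+_; _*_; _^_; _/_)
  import Data.Nat.Properties as ℕ
  open import Algebra.Properties.Semiring.Sum ℕ.+-*-semiring using (sum-syntax)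
  open import Data.Fin.Base using (toℕ)
  open import Data.Integer.Base using (+_)
  import Data.Integer.Properties as ℤ
  open import Data.Product using (∃; _,_; proj₁; proj₂)
  open import Data.Unit.Base using (tt)
  open import Function using (_∘_)
  open import Relation.Unary using (Pred; _∩_)
  import Relation.Binary.PropositionalEquality as ≡
  open FiniteGroup M
  open Subgroup using (order)
  open ElementaryAbelian M q
  open Layers M p
  open Involution M σ aut σ²≈id

  h : ℕ
  h = suc (p ^ n / 2)

  2h≈1 : ∀ x → (h + h) · x ≈ x
  2h≈1 x = begin
    (h + h) · x    ≡⟨ ≡.cong (_· x) (Parity.half (p ^ n) (Parity.odd-^ n (Parity.odd-prime prime odd))) ⟩
    x ∙ (p ^ n) · x ≈⟨ ∙-congˡ (p^n-kills x) ⟩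
    x ∙ ε           ≈⟨ identityʳ x ⟩
    x               ∎
    where open import Relation.Binary.Reasoning.Setoid setoid

  open Projections h 2h≈1
  open InvolutionDeterminant M q σ aut σ²≈id h 2h≈1
  open Counting using (count-all; count-cong)
  open Congruence using (_≡_mod_)
  open Valuation q using (ordp-pow)

  V-subspace : ∀ k → Subspace (InV M p k)
  V-subspace k = record
    { subgroup = subgroup-⇔ (λ (y , (_ , p^[1+k]y≈ε) , x≈p^ky) → y , p^[1+k]y≈ε , x≈p^ky)
                            (λ (y , p^[1+k]y≈ε , x≈p^ky) → y , (tt , p^[1+k]y≈ε) , x≈p^ky)
                            (layer whole k)
    ; killed   = λ (y , p^[1+k]y≈ε , x≈p^ky) → layer-killed whole {k} (y , (tt , p^[1+k]y≈ε) , x≈p^ky)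
    }

  V-stable : ∀ k → Stable (InV M p k)
  V-stable k (y , p^[1+k]y≈ε , x≈p^ky) =
    σ y , trans (sym (σ.×-homo (p ^ suc k) y)) (trans (σ.cong p^[1+k]y≈ε) σ.ε-homo) , trans (σ.cong x≈p^ky) (σ.×-homo (p ^ k) y)
    where module σ = IsEndomorphism σ-endomorphism

  -- the multiplicity of the eigenvalue -1 of σ on V_k
  e : ℕ → ℕ
  e k = proj₁ (basis (negated-part prime (V-subspace k) (V-stable k)) prime)

  det-on-layer : ∀ k (B : Basis M p k) A → IsMatrixOf M σ B A → detℤ M A ≡ negOnePowℕ (e k) mod + p
  det-on-layer k B A A-matrix =
    det-involution prime (V-subspace k) (V-stable k) basisOf A A-matrix (proj₂ (basis (negated-part prime (V-subspace k) (V-stable k)) prime))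
    where
    basisOf : BasisOf (InV M p k) (Basis.dim B)
    basisOf = record { vec = Basis.vec B ; ∈W = Basis.inV B ; span = Basis.span B ; indep = Basis.indep B }

  order-killed : ∀ {a} {H : Pred Carrier a} (S : Subgroup H) → order S ≡.≡ order (S ∩ˢ torsion (p ^ n))
  order-killed S = size-cong (Subgroup.dec S) (Subgroup.dec (S ∩ˢ torsion (p ^ n))) (λ Hx → Hx , p^n-kills _) proj₁

  order-pow : ∀ {a} {H : Pred Carrier a} (S : Subgroup H) → ∃ λ E → order S ≡.≡ p ^ E
  order-pow S = (∑[ i < n ] proj₁ (layer-basis (toℕ i))) , ≡.trans (order-killed S) (order-torsion S (proj₁ ∘ layer-basis) (λ k → order-basis (layer-space k) (proj₂ (layer-basis k))) n)
    where
    layer-space : ∀ k → Subspace (Layer S k)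
    layer-space k = record { subgroup = layer S k ; killed = layer-killed S {k} }
    layer-basis : ∀ k → ∃ (BasisOf (Layer S k))
    layer-basis k = basis (layer-space k) prime

  order-negated : order (whole ∩ˢ negated) ≡.≡ p ^ (∑[ i < n ] e (toℕ i))
  order-negated = ≡.trans (order-killed (whole ∩ˢ negated)) (order-torsion (whole ∩ˢ negated) e layer-order n)
    where
    layer-order : ∀ k → order (layer (whole ∩ˢ negated) k) ≡.≡ p ^ e k
    layer-order k = ≡.trans (size-cong (Subgroup.dec (layer (whole ∩ˢ negated) k)) (Subspace.dec negated-V) to-V from-V)
                            (order-basis negated-V (proj₂ (basis negated-V prime)))
      where
      negated-V = negated-part prime (V-subspace k) (V-stable k)
      to-V : ∀ {x} → Layer (whole ∩ˢ negated) k x → (InV M p k ∩ Negated) x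
      to-V (y , ((_ , σy≈y⁻¹) , p^[1+k]y≈ε) , x≈p^ky) =
        (y , p^[1+k]y≈ε , x≈p^ky) , Subgroup.resp negated (sym x≈p^ky) (Subgroup.×-closed negated (p ^ k) σy≈y⁻¹)
      from-V : ∀ {x} → (InV M p k ∩ Negated) x → Layer (whole ∩ˢ negated) k x
      from-V {x} ((y , p^[1+k]y≈ε , x≈p^ky) , σx≈x⁻¹) =
        π⁻ y , ((tt , π⁻-negated y) , trans (sym (π⁻.×-homo (p ^ suc k) y)) (trans (π⁻.cong p^[1+k]y≈ε) π⁻.ε-homo)) ,
        trans (sym (π⁻-on-negated σx≈x⁻¹)) (trans (π⁻.cong x≈p^ky) (π⁻.×-homo (p ^ k) y))
        where module π⁻ = IsEndomorphism π⁻-endomorphism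

  card-split : # M ≡.≡ order (whole ∩ˢ fixed) * order (whole ∩ˢ negated)
  card-split = ≡.trans (≡.sym (count-all (Subgroup.dec whole ∘ from) (λ _ → tt))) (order-split whole (λ _ → tt))

  #Fix≡order : #Fix M σ ≡.≡ order (whole ∩ˢ fixed)
  #Fix≡order = count-cong _ (Subgroup.dec (whole ∩ˢ fixed) ∘ from)
                 (λ i σi≡i → tt , to-injective (≡.trans σi≡i (≡.sym (to-from i))))
                 (λ i (_ , σx≈x) → ≡.trans (to-cong σx≈x) (to-from i))

  ordp≡∑e : ordp p (# M) (#Fix M σ) ≡.≡ + (∑[ i < n ] e (toℕ i))
  ordp≡∑e = ≡.trans (≡.cong₂ (ordp p) #M≡ #Fix≡) (ordp-pow E⁺ E)
    where
    E = ∑[ i < n ] e (toℕ i)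
    E⁺ = proj₁ (order-pow (whole ∩ˢ fixed))
    #Fix≡ : #Fix M σ ≡.≡ p ^ E⁺
    #Fix≡ = ≡.trans #Fix≡order (proj₂ (order-pow (whole ∩ˢ fixed)))
    #M≡ : # M ≡.≡ p ^ (E⁺ + E)
    #M≡ = ≡.trans card-split (≡.trans (≡.cong₂ _*_ (proj₂ (order-pow (whole ∩ˢ fixed))) order-negated) (≡.sym (ℕ.^-distribˡ-+-* p E⁺ E)))

open import Level using (Level)
open import Data.Nat using (ℕ; _^_; s≤s; z≤n; nonTrivial⇒n>1)
open import Data.Nat.Primality using (prime⇒nonTrivial)
open import Data.Fin using (Fin; toℕ)
open import Data.Integer using (+_; _-_)
open import Data.Integer.Divisibility using (_∣_)
open import Data.Integer.Divisibility.Signed using (∣⇒∣ᵤ)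
open import Data.Product using (_,_)
open import Function using (_∘_)
open import Relation.Binary.PropositionalEquality using (cong)
import Data.Nat.Properties
open import Algebra.Properties.Semiring.Sum Data.Nat.Properties.+-*-semiring using (sum-syntax)
open Congruence using (∏-cong-mod; divides-difference; module ≡-mod-Reasoning)

lemma2p3 : ∀ {c ℓ : Level} (p : ℕ) → Prime p → p ≢ 2 →
    (M : FiniteAbelianGroup c ℓ) → IsPGroup p M →
    (σ : FiniteAbelianGroup.Carrier M → FiniteAbelianGroup.Carrier M) →
    IsAut M σ → HasOrder2 M σ →
    (n : ℕ) → IsExponent M (p ^ n) →
    (B : (i : Fin n) → Basis M p (toℕ i)) →
    (A : (i : Fin n) → Fin (Basis.dim (B i)) → Fin (Basis.dim (B i)) → Fin p) →
    (∀ i → IsMatrixOf M σ (B i) (A i)) →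
    (+ p) ∣ (∏ (λ i → detℤ M (A i)) - negOnePow (ordp p (# M) (#Fix M σ)))
lemma2p3 p prime p≢2 M _ σ aut (σ²≈id , _) n (p^n-kills , _) B A A-matrix
  with nonTrivial⇒n>1 p {{prime⇒nonTrivial prime}}
... | s≤s (s≤s (z≤n {q})) = ∣⇒∣ᵤ (divides-difference (begin
    ∏ (λ i → detℤ M (A i))                     ≈⟨ ∏-cong-mod (λ i → det-on-layer (toℕ i) (B i) (A i) (A-matrix i)) ⟩
    ∏ (λ (i : Fin n) → negOnePowℕ (e (toℕ i))) ≡⟨ Parity.∏-negOnePowℕ {n} (e ∘ toℕ) ⟩
    negOnePowℕ (∑[ i < n ] e (toℕ i))          ≡⟨ cong negOnePow ordp≡∑e ⟨
    negOnePow (ordp p (# M) (#Fix M σ))         ∎))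
  where
  open OddInvolution q prime p≢2 M σ aut σ²≈id n p^n-kills
  open ≡-mod-Reasoning (+ p)
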